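{- Let $\mathbf a=(a_1,\dots,a_n)$ be an area sequence with $a_n=0$ such that $\Gamma_{\mathbf a}$ is connected, and let $b_j=\#\{i<j:\ j\le i+a_i\}$ for $j\in[n]$. Then \[\sum_{\substack{\theta\in AO(\Gamma_{\mathbf a})\\ \mathrm{Sinks}(\theta)=\{1\}}}q^{\mathrm{asc}(\theta)}=\prod_{i=1}^{n-1}[a_i]_q=\prod_{j=2}^{n}[b_j]_q.\]
   Context: $\mathbf a$ is an integer sequence with $0\le a_i\le n-1$, $a_i-1\le a_{i+1}$ (indices mod $n$) and $a_n=0$. $\Gamma_{\mathbf a}$ is the graph on $[n]$ with edges $\{i,j\}$ for $i<j\le i+a_i$. $AO(\Gamma_{\mathbf a})$ is the set of acyclic orientations; $\mathrm{asc}(\theta)$ is the number of edges $\{i,j\}$, $i<j$, oriented $i\to j$ in $\theta$; $\mathrm{Sinks}(\theta)$ is its set of sinks. $[m]_q=1+q+\dots+q^{m-1}$. -}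

module Defs where

open import Level using (Level)
open import Data.Bool.Base using (Bool; true; false; _∧_; _∨_; not; if_then_else_; T)
open import Data.Nat.Base using (ℕ; zero; suc; _+_; _≤_; _≡ᵇ_; _<ᵇ_; _≤ᵇ_; _%_)
open import Data.Fin.Base using (Fin; toℕ; inject₁) renaming (zero to fzero; suc to fsuc)
open import Data.List.Base using (List; []; _∷_; map; concatMap; filterᵇ; allFin; upTo; length; zip)
open import Data.Bool.ListAction using (any; all)
open import Data.Vec.Base using (Vec; toList) renaming ([] to []ᵥ; _∷_ to _∷ᵥ_)
open import Data.Product.Base using (_×_; _,_)
open import Data.Sum.Base using (_⊎_)
open import Relation.Binary.PropositionalEquality using (_≡_)
open import Algebra.Bundles using (CommutativeSemiring)

-- Vertices of Γ_a are Fin (suc m), i.e. [n] with n = suc m;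
-- Fin index k stands for vertex k+1 of the paper.

record IsAreaSeq {m : ℕ} (a : Fin (suc m) → ℕ) : Set where
  field
    bound : ∀ i → a i ≤ m
    step  : ∀ i j → toℕ j ≡ (suc (toℕ i)) % (suc m) → a i ≤ suc (a j)
    last0 : ∀ i → toℕ i ≡ m → a i ≡ 0

module _ {m : ℕ} (a : Fin (suc m) → ℕ) where

  Edge : Fin (suc m) → Fin (suc m) → Set
  Edge i j = (suc (toℕ i) ≤ toℕ j) × (toℕ j ≤ toℕ i + a i)

  isEdge : Fin (suc m) → Fin (suc m) → Bool
  isEdge i j = (toℕ i <ᵇ toℕ j) ∧ (toℕ j ≤ᵇ toℕ i + a i)

  data Reach : Fin (suc m) → Set where
    here : Reach fzero
    step : ∀ {u v} → Reach u → (Edge u v ⊎ Edge v u) → Reach v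

  Connected : Set
  Connected = ∀ v → Reach v

  edges : List (Fin (suc m) × Fin (suc m))
  edges = concatMap (λ i → map (λ j → (i , j)) (filterᵇ (isEdge i) (allFin (suc m)))) (allFin (suc m))

  -- an orientation: one bit per edge; true on edge (i,j) means i → j
  Orientation : Set
  Orientation = Vec Bool (length edges)

  _==_ : Fin (suc m) → Fin (suc m) → Bool
  u == v = toℕ u ≡ᵇ toℕ v

  arc : Orientation → Fin (suc m) → Fin (suc m) → Bool
  arc θ u v = any f (zip edges (toList θ))
    where
    f : (Fin (suc m) × Fin (suc m)) × Bool → Bool
    f ((i , j) , b) = ((i == u) ∧ (j == v) ∧ b) ∨ ((i == v) ∧ (j == u) ∧ not b)

  walk : Orientation → ℕ → Fin (suc m) → Fin (suc m) → Bool
  walk θ zero    u v = u == v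
  walk θ (suc k) u v = any (λ w → arc θ u w ∧ walk θ k w v) (allFin (suc m))

  -- θ has a directed cycle iff some vertex lies on a closed directed walk of
  -- length between 1 and n (a directed cycle has length ≤ n)
  hasCycle : Orientation → Bool
  hasCycle θ = any (λ v → any (λ k → walk θ (suc k) v v) (upTo (suc m))) (allFin (suc m))

  acyclic : Orientation → Bool
  acyclic θ = not (hasCycle θ)

  isSink : Orientation → Fin (suc m) → Bool
  isSink θ v = not (any (arc θ v) (allFin (suc m)))

  sinksIsOne : Orientation → Bool
  sinksIsOne θ = isSink θ fzero ∧ all (λ v → (v == fzero) ∨ not (isSink θ v)) (allFin (suc m))

  countTrue : ∀ {k} → Vec Bool k → ℕ
  countTrue []ᵥ = 0
  countTrue (true ∷ᵥ bs) = suc (countTrue bs)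
  countTrue (false ∷ᵥ bs) = countTrue bs

  asc : Orientation → ℕ
  asc θ = countTrue θ

  b : Fin (suc m) → ℕ
  b j = length (filterᵇ (λ i → isEdge i j) (allFin (suc m)))

allVecs : (k : ℕ) → List (Vec Bool k)
allVecs zero = []ᵥ ∷ []
allVecs (suc k) = map (true ∷ᵥ_) (allVecs k) Data.List.Base.++ map (false ∷ᵥ_) (allVecs k)
  where import Data.List.Base

-- Polynomial identities in q are stated in an arbitrary commutative
-- semiring R at an arbitrary element q (R = ℕ[q] gives the identity of
-- polynomials).

module Poly {c ℓ : Level} (R : CommutativeSemiring c ℓ) where
  open CommutativeSemiring R using (Carrier; 0#; 1#) renaming (_+_ to _⊕_; _*_ to _⊛_)

  pow : Carrier → ℕ → Carrier
  pow q zero = 1#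
  pow q (suc k) = q ⊛ pow q k

  sumL : List Carrier → Carrier
  sumL [] = 0#
  sumL (x ∷ xs) = x ⊕ sumL xs

  prodL : List Carrier → Carrier
  prodL [] = 1#
  prodL (x ∷ xs) = x ⊛ prodL xs

  qint : Carrier → ℕ → Carrier
  qint q k = sumL (map (pow q) (upTo k))

  sinkOneGF : {m : ℕ} → (Fin (suc m) → ℕ) → Carrier → Carrier
  sinkOneGF a q = sumL (map (λ θ → if acyclic a θ ∧ sinksIsOne a θ then pow q (asc a θ) else 0#)
                            (allVecs (length (edges a))))

  prodA : {m : ℕ} → (Fin (suc m) → ℕ) → Carrier → Carrier
  prodA {m} a q = prodL (map (λ i → qint q (a (inject₁ i))) (allFin m))

  prodB : {m : ℕ} → (Fin (suc m) → ℕ) → Carrier → Carrier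
  prodB {m} a q = prodL (map (λ i → qint q (b a (fsuc i))) (allFin m))

module Submission where

-- Write G_k(a) for the sum of q^asc over the acyclic orientations of Γ_a all of whose sinks
-- lie among the first k vertices, and c = min(a₁, n - 1). We show G_k(a) = [k]_q ∏_i [min(a_i, n - i)]_q
-- for 1 ≤ k ≤ c + 1 by deleting the first vertex; k = 1 is the theorem, as an acyclic orientation
-- always has a sink. Since i + a_i is nondecreasing, the c neighbours of vertex 1 form a clique of
-- Γ_{a'}, a' = (a₂, …, a_n), on which an acyclic orientation ρ of Γ_{a'} is a transitive tournament.
-- Orienting the c edges at vertex 1 extends ρ acyclically exactly when the out-neighbours of 1 form an
-- up-set of that tournament, i.e. one of its c + 1 final segments. If vertex 1 is a sink, the
-- condition on the sinks is that ρ has all its sinks in the clique; otherwise the sinks are those of ρ.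
-- Hence G_k(a) = G_c(a') + q [c]_q G_{k-1}(a') = [c]_q (1 + q [k-1]_q) ∏' = [k]_q [c]_q ∏'.
-- The product of the [b_j]_q is the same product regrouped: the neighbours 2, …, c + 1 of vertex 1
-- have b_j = 1, …, c, which removing vertex 1 lowers by one.

open import Defs
open import Data.Nat.Base using (ℕ; suc)
open import Data.Fin.Base using (Fin)
open import Data.Product.Base using (_×_)
open import Algebra.Bundles using (CommutativeSemiring)


module BooleanLists where

  open import Data.Bool.Base using (Bool; true; false; _∧_; _∨_; not; if_then_else_)
  open import Data.Nat.Base using (zero; suc; _<_; _≤_; z≤n; s≤s; _≡ᵇ_; _<ᵇ_; _≤ᵇ_)
  open import Data.Nat.Properties using (suc-injective)
  open import Data.Fin.Base using (Fin; toℕ) renaming (zero to fzero; suc to fsuc)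
  open import Data.Fin.Properties using (toℕ-injective)
  open import Data.List.Base using (List; []; _∷_; map; allFin; _++_; length; zip; filterᵇ; foldr)
  open import Data.List.Properties using (map-tabulate; map-∘)
  open import Data.Bool.ListAction using (any; all)
  open import Data.List.Membership.Propositional using (_∈_)
  open import Data.List.Relation.Unary.Any using (here; there)
  open import Data.Product.Base using (Σ; _×_; _,_; proj₁; proj₂)
  open import Data.Sum.Base using (_⊎_; inj₁; inj₂)
  open import Data.Empty using (⊥; ⊥-elim)
  open import Function.Base using (_∘_)
  open import Relation.Binary.PropositionalEquality

  true≢false : ∀ {x : Bool} → x ≡ true → x ≡ false → ⊥
  true≢false refl ()

  ∨≡true⇒ : ∀ {x y : Bool} → x ∨ y ≡ true → x ≡ true ⊎ y ≡ true
  ∨≡true⇒ {true} _ = inj₁ refl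
  ∨≡true⇒ {false} p = inj₂ p

  ∧≡true⇒ : ∀ {x y : Bool} → x ∧ y ≡ true → x ≡ true × y ≡ true
  ∧≡true⇒ {true} {true} _ = refl , refl

  not≡true⇒ : ∀ {x} → not x ≡ true → x ≡ false
  not≡true⇒ {false} _ = refl

  not≡false⇒ : ∀ {x} → not x ≡ false → x ≡ true
  not≡false⇒ {true} _ = refl

  ≡-fromImplications : ∀ {x y : Bool} → (x ≡ true → y ≡ true) → (y ≡ true → x ≡ true) → x ≡ y
  ≡-fromImplications {false} {false} f g = refl
  ≡-fromImplications {false} {true} f g = g refl
  ≡-fromImplications {true} {false} f g = sym (f refl)
  ≡-fromImplications {true} {true} f g = refl

  any-cong : ∀ {A : Set} (f g : A → Bool) → (∀ x → f x ≡ g x) → ∀ xs → any f xs ≡ any g xs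
  any-cong f g e [] = refl
  any-cong f g e (x ∷ xs) = cong₂ _∨_ (e x) (any-cong f g e xs)

  all-cong : ∀ {A : Set} (f g : A → Bool) → (∀ x → f x ≡ g x) → ∀ xs → all f xs ≡ all g xs
  all-cong f g e [] = refl
  all-cong f g e (x ∷ xs) = cong₂ _∧_ (e x) (all-cong f g e xs)

  any-++ : ∀ {A : Set} (f : A → Bool) xs ys → any f (xs ++ ys) ≡ any f xs ∨ any f ys
  any-++ f [] ys = refl
  any-++ f (x ∷ xs) ys with f x
  ... | true = refl
  ... | false = any-++ f xs ys

  any-map : ∀ {A B : Set} (g : B → Bool) (h : A → B) xs → any g (map h xs) ≡ any (g ∘ h) xs
  any-map g h xs = cong (foldr _∨_ false) (sym (map-∘ xs))

  any-false : ∀ {A : Set} (g : A → Bool) → (∀ x → g x ≡ false) → ∀ xs → any g xs ≡ false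
  any-false g e [] = refl
  any-false g e (x ∷ xs) rewrite e x = any-false g e xs

  any≡true⁻ : ∀ {A : Set} (f : A → Bool) xs → any f xs ≡ true → Σ A λ x → x ∈ xs × f x ≡ true
  any≡true⁻ f (x ∷ xs) p with f x in eq
  ... | true = x , here refl , eq
  ... | false with any≡true⁻ f xs p
  ... | y , y∈xs , fy = y , there y∈xs , fy

  any≡true⁺ : ∀ {A : Set} (f : A → Bool) {xs x} → x ∈ xs → f x ≡ true → any f xs ≡ true
  any≡true⁺ f {x ∷ xs} (here refl) fx rewrite fx = refl
  any≡true⁺ f {x ∷ xs} (there y∈xs) fy with f x
  ... | true = refl
  ... | false = any≡true⁺ f y∈xs fy

  any≡false⇒ : ∀ {A : Set} (f : A → Bool) {xs x} → any f xs ≡ false → x ∈ xs → f x ≡ false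
  any≡false⇒ f {x = x} p x∈xs with f x in fx
  ... | false = refl
  ... | true = ⊥-elim (true≢false (any≡true⁺ f x∈xs fx) p)

  all≡true⁻ : ∀ {A : Set} (f : A → Bool) {xs x} → all f xs ≡ true → x ∈ xs → f x ≡ true
  all≡true⁻ f {y ∷ xs} p (here refl) = proj₁ (∧≡true⇒ p)
  all≡true⁻ f {y ∷ xs} p (there x∈xs) = all≡true⁻ f (proj₂ (∧≡true⇒ {f y} p)) x∈xs

  all≡true⁺ : ∀ {A : Set} (f : A → Bool) xs → (∀ x → x ∈ xs → f x ≡ true) → all f xs ≡ true
  all≡true⁺ f [] h = refl
  all≡true⁺ f (x ∷ xs) h rewrite h x (here refl) = all≡true⁺ f xs (λ y y∈xs → h y (there y∈xs))

  filterᵇ-∷ : ∀ {A : Set} (p : A → Bool) x xs →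
              filterᵇ p (x ∷ xs) ≡ (if p x then x ∷ filterᵇ p xs else filterᵇ p xs)
  filterᵇ-∷ p x xs with p x
  ... | true = refl
  ... | false = refl

  filterᵇ-map : ∀ {A B : Set} (p : B → Bool) (f : A → B) xs → filterᵇ p (map f xs) ≡ map f (filterᵇ (p ∘ f) xs)
  filterᵇ-map p f [] = refl
  filterᵇ-map p f (x ∷ xs) rewrite filterᵇ-∷ p (f x) (map f xs) | filterᵇ-∷ (p ∘ f) x xs with p (f x)
  ... | true = cong (f x ∷_) (filterᵇ-map p f xs)
  ... | false = filterᵇ-map p f xs

  filterᵇ-cong : ∀ {A : Set} (p p' : A → Bool) → (∀ x → p x ≡ p' x) → ∀ xs → filterᵇ p xs ≡ filterᵇ p' xs
  filterᵇ-cong p p' e [] = refl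
  filterᵇ-cong p p' e (x ∷ xs) rewrite filterᵇ-∷ p x xs | filterᵇ-∷ p' x xs | e x with p' x
  ... | true = cong (x ∷_) (filterᵇ-cong p p' e xs)
  ... | false = filterᵇ-cong p p' e xs

  filterᵇ-none : ∀ {A : Set} (p : A → Bool) → (∀ x → p x ≡ false) → ∀ xs → filterᵇ p xs ≡ []
  filterᵇ-none p e [] = refl
  filterᵇ-none p e (x ∷ xs) rewrite filterᵇ-∷ p x xs | e x = filterᵇ-none p e xs

  ∈-filterᵇ⁺ : ∀ {A : Set} (p : A → Bool) {x xs} → x ∈ xs → p x ≡ true → x ∈ filterᵇ p xs
  ∈-filterᵇ⁺ p {x} {y ∷ xs} (here refl) px rewrite filterᵇ-∷ p y xs | px = here refl
  ∈-filterᵇ⁺ p {x} {y ∷ xs} (there x∈xs) px rewrite filterᵇ-∷ p y xs with p y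
  ... | true = there (∈-filterᵇ⁺ p x∈xs px)
  ... | false = ∈-filterᵇ⁺ p x∈xs px

  zip-++ : ∀ {A B : Set} (xs ys : List A) (us vs : List B) → length xs ≡ length us →
           zip (xs ++ ys) (us ++ vs) ≡ zip xs us ++ zip ys vs
  zip-++ [] ys [] vs _ = refl
  zip-++ (x ∷ xs) ys (u ∷ us) vs e = cong ((x , u) ∷_) (zip-++ xs ys us vs (suc-injective e))

  zip-mapˡ : ∀ {A A' B : Set} (f : A → A') (xs : List A) (us : List B) →
             zip (map f xs) us ≡ map (λ p → (f (proj₁ p) , proj₂ p)) (zip xs us)
  zip-mapˡ f [] us = refl
  zip-mapˡ f (x ∷ xs) [] = refl
  zip-mapˡ f (x ∷ xs) (u ∷ us) = cong (_ ∷_) (zip-mapˡ f xs us)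

  ∈-zipˡ : ∀ {A B : Set} {e : A} {es : List A} (bs : List B) → e ∈ es → length es ≡ length bs →
           Σ B λ b → (e , b) ∈ zip es bs
  ∈-zipˡ (b ∷ bs) (here refl) _ = b , here refl
  ∈-zipˡ (b ∷ bs) (there e∈es) l with ∈-zipˡ bs e∈es (suc-injective l)
  ... | b' , m = b' , there m

  allFin-suc : ∀ n → allFin (suc n) ≡ fzero ∷ map fsuc (allFin n)
  allFin-suc n = cong (fzero ∷_) (sym (map-tabulate (λ x → x) fsuc))

  ≡ᵇ-refl : ∀ n → (n ≡ᵇ n) ≡ true
  ≡ᵇ-refl zero = refl
  ≡ᵇ-refl (suc n) = ≡ᵇ-refl n

  ≡ᵇ≡true⇒≡ : ∀ m n → (m ≡ᵇ n) ≡ true → m ≡ n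
  ≡ᵇ≡true⇒≡ zero zero _ = refl
  ≡ᵇ≡true⇒≡ (suc m) (suc n) p = cong suc (≡ᵇ≡true⇒≡ m n p)

  <ᵇ-suc : ∀ x y → (x <ᵇ suc y) ≡ (x ≤ᵇ y)
  <ᵇ-suc zero y = refl
  <ᵇ-suc (suc x) y = refl

  <ᵇ≡true⇒< : ∀ x y → (x <ᵇ y) ≡ true → x < y
  <ᵇ≡true⇒< zero (suc y) _ = s≤s z≤n
  <ᵇ≡true⇒< (suc x) (suc y) p = s≤s (<ᵇ≡true⇒< x y p)

  <⇒<ᵇ≡true : ∀ {x y} → x < y → (x <ᵇ y) ≡ true
  <⇒<ᵇ≡true {zero} (s≤s _) = refl
  <⇒<ᵇ≡true {suc x} (s≤s h) = <⇒<ᵇ≡true h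

  ≤⇒≤ᵇ≡true : ∀ {x y} → x ≤ y → (x ≤ᵇ y) ≡ true
  ≤⇒≤ᵇ≡true {zero} _ = refl
  ≤⇒≤ᵇ≡true {suc x} h = <⇒<ᵇ≡true h

  eqᵇ : ∀ {n} → Fin n → Fin n → Bool
  eqᵇ u v = toℕ u ≡ᵇ toℕ v

  eqᵇ-refl : ∀ {n} (u : Fin n) → eqᵇ u u ≡ true
  eqᵇ-refl u = ≡ᵇ-refl (toℕ u)

  eqᵇ≡true⇒≡ : ∀ {n} (u v : Fin n) → eqᵇ u v ≡ true → u ≡ v
  eqᵇ≡true⇒≡ u v p = toℕ-injective (≡ᵇ≡true⇒≡ _ _ p)

module Digraphs where

  open import Data.Bool.Base using (Bool; true; false; _∧_; not)
  open import Data.Nat.Base using (ℕ; zero; suc; _+_; _∸_; _≤_; _<_; s≤s)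
  open import Data.Nat.Properties
  open import Data.Fin.Base using (Fin; toℕ)
  open import Data.Fin.Properties using (pigeonhole; toℕ≤pred[n])
  open import Data.List.Base using (allFin; upTo)
  open import Data.Bool.ListAction using (any)
  open import Data.List.Membership.Propositional.Properties using (∈-allFin; ∈-upTo⁺; ∈-upTo⁻)
  open import Data.Product.Base using (Σ; _×_; _,_; proj₁; proj₂)
  open import Data.Empty using (⊥; ⊥-elim)
  open import Relation.Binary.PropositionalEquality
  open import Relation.Nullary using (yes; no)
  open BooleanLists

  module Digraph {n : ℕ} (R : Fin n → Fin n → Bool) where

    data Path : ℕ → Fin n → Fin n → Set where
      []  : ∀ {v} → Path 0 v v
      _∷_ : ∀ {k u w v} → R u w ≡ true → Path k w v → Path (suc k) u v

    _++ᵖ_ : ∀ {k l u w v} → Path k u w → Path l w v → Path (k + l) u v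
    [] ++ᵖ q = q
    (e ∷ p) ++ᵖ q = e ∷ (p ++ᵖ q)

    Acyclic : Set
    Acyclic = ∀ v L → Path (suc L) v v → ⊥

    walkR : ℕ → Fin n → Fin n → Bool
    walkR zero u v = eqᵇ u v
    walkR (suc k) u v = any (λ w → R u w ∧ walkR k w v) (allFin n)

    hasCycleR : Bool
    hasCycleR = any (λ v → any (λ k → walkR (suc k) v v) (upTo n)) (allFin n)

    isSinkR : Fin n → Bool
    isSinkR v = not (any (R v) (allFin n))

    SinksBelow : ℕ → Set
    SinksBelow k = ∀ v → isSinkR v ≡ true → toℕ v < k

    walk⇒path : ∀ k u v → walkR k u v ≡ true → Path k u v
    walk⇒path zero u v p with eqᵇ≡true⇒≡ u v p
    ... | refl = []
    walk⇒path (suc k) u v p with any≡true⁻ _ (allFin n) p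
    ... | w , _ , q = proj₁ (∧≡true⇒ q) ∷ walk⇒path k w v (proj₂ (∧≡true⇒ {R u w} q))

    path⇒walk : ∀ {k u v} → Path k u v → walkR k u v ≡ true
    path⇒walk {u = u} [] = eqᵇ-refl u
    path⇒walk {u = u} (_∷_ {k = k} {w = w} {v = v} e p) =
      any≡true⁺ (λ w → R u w ∧ walkR k w v) (∈-allFin w) (cong₂ _∧_ e (path⇒walk p))

    vertexAt : ∀ {k u v} → Path k u v → ℕ → Fin n
    vertexAt {u = u} p zero = u
    vertexAt {v = v} [] (suc t) = v
    vertexAt (e ∷ p) (suc t) = vertexAt p t

    dropPath : ∀ {k u v} i (p : Path k u v) → i ≤ k → Path (k ∸ i) (vertexAt p i) v
    dropPath zero p _ = p
    dropPath (suc i) (e ∷ p) (s≤s h) = dropPath i p h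

    takePath : ∀ {k u v} d (p : Path k u v) → d ≤ k → Path d u (vertexAt p d)
    takePath zero p _ = []
    takePath (suc d) (e ∷ p) (s≤s h) = e ∷ takePath d p h

    vertexAt-dropPath : ∀ {k u v} i (p : Path k u v) (h : i ≤ k) t →
                        vertexAt (dropPath i p h) t ≡ vertexAt p (i + t)
    vertexAt-dropPath zero p h t = refl
    vertexAt-dropPath (suc i) (e ∷ p) (s≤s h) t = vertexAt-dropPath i p h t

    ShortCycle : Set
    ShortCycle = Σ (Fin n) λ w → Σ ℕ λ k → k < n × Path (suc k) w w

    shortCycle : ∀ {L u v} → Path L u v → n ≤ L → ShortCycle
    shortCycle {L} p n≤L with pigeonhole (n<1+n n) (λ t → vertexAt p (toℕ t))
    ... | i , j , i<j , same = vertexAt p (toℕ i) , d ∸ 1 , d∸1<n , subst (λ k → Path k (vertexAt p (toℕ i)) (vertexAt p (toℕ i))) d≡ cycle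
      where
      j≤n : toℕ j ≤ n
      j≤n = toℕ≤pred[n] j
      i≤L : toℕ i ≤ L
      i≤L = ≤-trans (<⇒≤ i<j) (≤-trans j≤n n≤L)
      d : ℕ
      d = toℕ j ∸ toℕ i
      segment : Path d (vertexAt p (toℕ i)) (vertexAt (dropPath (toℕ i) p i≤L) d)
      segment = takePath d (dropPath (toℕ i) p i≤L) (∸-monoˡ-≤ (toℕ i) (≤-trans j≤n n≤L))
      closes : vertexAt (dropPath (toℕ i) p i≤L) d ≡ vertexAt p (toℕ i)
      closes = trans (vertexAt-dropPath (toℕ i) p i≤L d)
                     (trans (cong (vertexAt p) (m+[n∸m]≡n (<⇒≤ i<j))) (sym same))
      cycle : Path d (vertexAt p (toℕ i)) (vertexAt p (toℕ i))
      cycle = subst (Path d _) closes segment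
      d≡ : d ≡ suc (d ∸ 1)
      d≡ = sym (m+[n∸m]≡n {1} {d} (m<n⇒0<n∸m i<j))
      d∸1<n : d ∸ 1 < n
      d∸1<n = ≤-trans (≤-reflexive (sym d≡)) (≤-trans (m∸n≤m (toℕ j) (toℕ i)) j≤n)

    shortCycle⇒hasCycle : ShortCycle → hasCycleR ≡ true
    shortCycle⇒hasCycle (w , k , k<n , p) =
      any≡true⁺ (λ v → any (λ k → walkR (suc k) v v) (upTo n)) (∈-allFin w)
        (any≡true⁺ (λ k → walkR (suc k) w w) (∈-upTo⁺ k<n) (path⇒walk p))

    hasCycle⇒shortCycle : hasCycleR ≡ true → ShortCycle
    hasCycle⇒shortCycle p with any≡true⁻ _ (allFin n) p
    ... | w , _ , q with any≡true⁻ _ (upTo n) q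
    ... | k , k∈ , r = w , k , ∈-upTo⁻ k∈ , walk⇒path (suc k) w w r

    noCycle⇒acyclic : not hasCycleR ≡ true → Acyclic
    noCycle⇒acyclic p v L c = true≢false (shortCycle⇒hasCycle cyc) (not≡true⇒ p)
      where
      cyc : ShortCycle
      cyc with suc L ≤? n
      ... | yes h = v , L , h , c
      ... | no h = shortCycle c (m≤n⇒m≤1+n (≮⇒≥ h))

    acyclic⇒noCycle : Acyclic → not hasCycleR ≡ true
    acyclic⇒noCycle A with hasCycleR in eq
    ... | false = refl
    ... | true with hasCycle⇒shortCycle eq
    ... | w , k , _ , c = ⊥-elim (A w k c)

    isSink⇒noArc : ∀ v → isSinkR v ≡ true → ∀ w → R v w ≡ false
    isSink⇒noArc v p w = any≡false⇒ (R v) (not≡true⇒ p) (∈-allFin w)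

    noArc⇒isSink : ∀ v → (∀ w → R v w ≡ false) → isSinkR v ≡ true
    noArc⇒isSink v h = cong not (any-false (R v) h (allFin n))

    nonSink⇒arc : ∀ v → isSinkR v ≡ false → Σ (Fin n) λ w → R v w ≡ true
    nonSink⇒arc v p with any≡true⁻ (R v) (allFin n) (not≡false⇒ p)
    ... | w , _ , q = w , q

    pathFrom : (∀ v → isSinkR v ≡ false) → ∀ L u → Σ (Fin n) λ v → Path L u v
    pathFrom noSink zero u = u , []
    pathFrom noSink (suc L) u with nonSink⇒arc u (noSink u)
    ... | w , e with pathFrom noSink L w
    ... | v , p = v , (e ∷ p)

    acyclic⇒sink : Acyclic → Fin n → Σ (Fin n) λ v → isSinkR v ≡ true
    acyclic⇒sink A u with any isSinkR (allFin n) in eq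
    ... | true with any≡true⁻ isSinkR (allFin n) eq
    ...   | v , _ , s = v , s
    acyclic⇒sink A u | false
      with shortCycle (proj₂ (pathFrom (λ v → any≡false⇒ isSinkR eq (∈-allFin v)) n u)) ≤-refl
    ... | w , k , _ , c = ⊥-elim (A w k c)

module Tournaments where

  open import Data.Bool.Base using (Bool; true; false; _∧_; not; if_then_else_)
  open import Data.Nat.Base using (ℕ; zero; suc)
  open import Data.Fin.Base using (Fin; punchIn; punchOut) renaming (zero to fzero; suc to fsuc)
  open import Data.Fin.Properties using (_≟_; suc-injective; punchIn-injective; punchInᵢ≢i; punchIn-punchOut)
  open import Data.Vec.Base using (Vec; lookup; insertAt) renaming ([] to []ᵥ; _∷_ to _∷ᵥ_)
  open import Data.Vec.Properties using (insertAt-lookup; insertAt-punchIn)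
  open import Data.List.Base using (allFin)
  open import Data.Bool.ListAction using (all)
  open import Data.List.Membership.Propositional.Properties using (∈-allFin)
  open import Data.Product.Base using (Σ; _,_; proj₁; proj₂)
  open import Data.Sum.Base using (_⊎_; inj₁; inj₂)
  open import Data.Empty using (⊥-elim)
  open import Relation.Nullary using (yes; no; ¬_)
  open import Relation.Binary.PropositionalEquality
  open BooleanLists

  allTrue : ∀ {k} → Vec Bool k → Bool
  allTrue []ᵥ = true
  allTrue (b ∷ᵥ σ) = b ∧ allTrue σ

  allFalse : ∀ {k} → Vec Bool k → Bool
  allFalse []ᵥ = true
  allFalse (b ∷ᵥ σ) = not b ∧ allFalse σ

  trueCount : ∀ {k} → Vec Bool k → ℕ
  trueCount []ᵥ = 0
  trueCount (true ∷ᵥ σ) = suc (trueCount σ)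
  trueCount (false ∷ᵥ σ) = trueCount σ

  allTrue⇒ : ∀ {k} (σ : Vec Bool k) → allTrue σ ≡ true → ∀ i → lookup σ i ≡ true
  allTrue⇒ (b ∷ᵥ σ) p fzero = proj₁ (∧≡true⇒ p)
  allTrue⇒ (b ∷ᵥ σ) p (fsuc i) = allTrue⇒ σ (proj₂ (∧≡true⇒ {b} p)) i

  allTrue⇐ : ∀ {k} (σ : Vec Bool k) → (∀ i → lookup σ i ≡ true) → allTrue σ ≡ true
  allTrue⇐ []ᵥ h = refl
  allTrue⇐ (b ∷ᵥ σ) h rewrite h fzero = allTrue⇐ σ (λ i → h (fsuc i))

  allFalse⇒ : ∀ {k} (σ : Vec Bool k) → allFalse σ ≡ true → ∀ i → lookup σ i ≡ false
  allFalse⇒ (b ∷ᵥ σ) p fzero = not≡true⇒ (proj₁ (∧≡true⇒ p))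
  allFalse⇒ (b ∷ᵥ σ) p (fsuc i) = allFalse⇒ σ (proj₂ (∧≡true⇒ {not b} p)) i

  ¬allFalse⇒ : ∀ {k} (σ : Vec Bool k) → allFalse σ ≡ false → Σ (Fin k) λ i → lookup σ i ≡ true
  ¬allFalse⇒ (true ∷ᵥ σ) p = fzero , refl
  ¬allFalse⇒ (false ∷ᵥ σ) p with ¬allFalse⇒ σ p
  ... | i , q = fsuc i , q

  allFalse⇒trueCount≡0 : ∀ {k} (σ : Vec Bool k) → allFalse σ ≡ true → trueCount σ ≡ 0
  allFalse⇒trueCount≡0 []ᵥ p = refl
  allFalse⇒trueCount≡0 (false ∷ᵥ σ) p = allFalse⇒trueCount≡0 σ p

  allTrue⇒trueCount≡length : ∀ {k} (σ : Vec Bool k) → allTrue σ ≡ true → trueCount σ ≡ k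
  allTrue⇒trueCount≡length []ᵥ p = refl
  allTrue⇒trueCount≡length (true ∷ᵥ σ) p = cong suc (allTrue⇒trueCount≡length σ p)

  allFalse-insertAt : ∀ {k} (σ : Vec Bool k) t b → allFalse (insertAt σ t b) ≡ not b ∧ allFalse σ
  allFalse-insertAt σ fzero b = refl
  allFalse-insertAt (x ∷ᵥ σ) (fsuc t) b rewrite allFalse-insertAt σ t b with b | x
  ... | true | true = refl
  ... | true | false = refl
  ... | false | _ = refl

  trueCount-insertAt : ∀ {k} (σ : Vec Bool k) t b →
                       trueCount (insertAt σ t b) ≡ (if b then suc (trueCount σ) else trueCount σ)
  trueCount-insertAt σ fzero true = refl
  trueCount-insertAt σ fzero false = refl
  trueCount-insertAt (true ∷ᵥ σ) (fsuc t) b rewrite trueCount-insertAt σ t b with b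
  ... | true = refl
  ... | false = refl
  trueCount-insertAt (false ∷ᵥ σ) (fsuc t) b = trueCount-insertAt σ t b

  Total Asymmetric Transitive : ∀ {c} → (Fin c → Fin c → Bool) → Set
  Total T = ∀ i j → ¬ i ≡ j → T i j ≡ true ⊎ T j i ≡ true
  Asymmetric T = ∀ i j → T i j ≡ true → T j i ≡ false
  Transitive T = ∀ i j k → T i j ≡ true → T j k ≡ true → T i k ≡ true

  IsSource : ∀ {c} → (Fin c → Fin c → Bool) → Fin c → Set
  IsSource T t = ∀ j → ¬ t ≡ j → T t j ≡ true

  source : ∀ {c} (T : Fin (suc c) → Fin (suc c) → Bool) → Total T → Transitive T → Σ (Fin (suc c)) (IsSource T)
  source {zero} T tot tr = fzero , λ { fzero h → ⊥-elim (h refl) }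
  source {suc c} T tot tr with source {c} (λ i j → T (fsuc i) (fsuc j))
                                  (λ i j ne → tot (fsuc i) (fsuc j) (λ e → ne (suc-injective e)))
                                  (λ i j k → tr (fsuc i) (fsuc j) (fsuc k))
  ... | s , s-source with tot fzero (fsuc s) (λ ())
  ... | inj₁ T0s = fzero , zero-source
    where
    zero-source : IsSource T fzero
    zero-source fzero h = ⊥-elim (h refl)
    zero-source (fsuc j) h with s ≟ j
    ... | yes refl = T0s
    ... | no ne = tr fzero (fsuc s) (fsuc j) T0s (s-source j ne)
  ... | inj₂ Ts0 = fsuc s , suc-source
    where
    suc-source : IsSource T (fsuc s)
    suc-source fzero _ = Ts0
    suc-source (fsuc j) h = s-source j (λ e → h (cong fsuc e))

  module UpClosure {c : ℕ} (T : Fin c → Fin c → Bool) where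

    IsUpClosed : Vec Bool c → Set
    IsUpClosed σ = ∀ i j → lookup σ i ≡ true → T i j ≡ true → lookup σ j ≡ true

    isUpClosed : Vec Bool c → Bool
    isUpClosed σ = all (λ i → all (λ j → not (lookup σ i ∧ T i j ∧ not (lookup σ j))) (allFin c)) (allFin c)

    isUpClosed-sound : ∀ σ → isUpClosed σ ≡ true → IsUpClosed σ
    isUpClosed-sound σ p i j σi Tij with lookup σ j in σj
    ... | true = refl
    ... | false = ⊥-elim (true≢false (subst₂ (λ x y → not (x ∧ y ∧ true) ≡ true) σi Tij violation) refl)
      where
      violation : not (lookup σ i ∧ T i j ∧ not false) ≡ true
      violation = subst (λ z → not (lookup σ i ∧ T i j ∧ not z) ≡ true) σj
                    (all≡true⁻ _ (all≡true⁻ _ p (∈-allFin i)) (∈-allFin j))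

    isUpClosed-complete : ∀ σ → IsUpClosed σ → isUpClosed σ ≡ true
    isUpClosed-complete σ h = all≡true⁺ _ (allFin c) λ i _ → all≡true⁺ _ (allFin c) λ j _ → noViolation i j
      where
      noViolation : ∀ i j → not (lookup σ i ∧ T i j ∧ not (lookup σ j)) ≡ true
      noViolation i j with lookup σ i in σi | T i j in Tij
      ... | false | _ = refl
      ... | true | false = refl
      ... | true | true rewrite h i j σi Tij = refl

  module DeleteVertex {c : ℕ} (T : Fin (suc c) → Fin (suc c) → Bool) (t : Fin (suc c)) where

    T⁻ : Fin c → Fin c → Bool
    T⁻ i j = T (punchIn t i) (punchIn t j)

    total⁻ : Total T → Total T⁻
    total⁻ tot i j ne = tot _ _ (λ e → ne (punchIn-injective t i j e))

    asymmetric⁻ : Asymmetric T → Asymmetric T⁻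
    asymmetric⁻ as i j = as _ _

    transitive⁻ : Transitive T → Transitive T⁻
    transitive⁻ tr i j k = tr _ _ _

    open UpClosure T using (isUpClosed; isUpClosed-sound; isUpClosed-complete)
    open UpClosure T⁻ using () renaming (isUpClosed to isUpClosed⁻;
      isUpClosed-sound to isUpClosed⁻-sound; isUpClosed-complete to isUpClosed⁻-complete)

    t-or-punchIn : ∀ j → j ≡ t ⊎ Σ (Fin c) λ i → punchIn t i ≡ j
    t-or-punchIn j with t ≟ j
    ... | yes e = inj₁ (sym e)
    ... | no ne = inj₂ (punchOut ne , punchIn-punchOut ne)

    module _ (t-source : IsSource T t) where

      source≢ : ∀ i → T t (punchIn t i) ≡ true
      source≢ i = t-source (punchIn t i) (λ e → punchInᵢ≢i t i (sym e))

      isUpClosed-insertTrue : ∀ σ → isUpClosed (insertAt σ t true) ≡ allTrue σ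
      isUpClosed-insertTrue σ = ≡-fromImplications to from
        where
        to : isUpClosed (insertAt σ t true) ≡ true → allTrue σ ≡ true
        to p = allTrue⇐ σ λ i →
          trans (sym (insertAt-punchIn σ t true i))
            (isUpClosed-sound (insertAt σ t true) p t (punchIn t i) (insertAt-lookup σ t true) (source≢ i))
        from : allTrue σ ≡ true → isUpClosed (insertAt σ t true) ≡ true
        from p = isUpClosed-complete (insertAt σ t true) λ _ j _ _ → allSet j
          where
          allSet : ∀ j → lookup (insertAt σ t true) j ≡ true
          allSet j with t-or-punchIn j
          ... | inj₁ refl = insertAt-lookup σ t true
          ... | inj₂ (i , refl) = trans (insertAt-punchIn σ t true i) (allTrue⇒ σ p i)

      isUpClosed-insertFalse : Asymmetric T → ∀ σ → isUpClosed (insertAt σ t false) ≡ isUpClosed⁻ σ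
      isUpClosed-insertFalse as σ = ≡-fromImplications to from
        where
        to : isUpClosed (insertAt σ t false) ≡ true → isUpClosed⁻ σ ≡ true
        to p = isUpClosed⁻-complete σ λ i j σi Tij →
          trans (sym (insertAt-punchIn σ t false j))
            (isUpClosed-sound (insertAt σ t false) p (punchIn t i) (punchIn t j)
               (trans (insertAt-punchIn σ t false i) σi) Tij)
        from : isUpClosed⁻ σ ≡ true → isUpClosed (insertAt σ t false) ≡ true
        from p = isUpClosed-complete (insertAt σ t false) closed
          where
          closed : UpClosure.IsUpClosed T (insertAt σ t false)
          closed i j σi Tij with t-or-punchIn i
          ... | inj₁ refl = ⊥-elim (true≢false σi (insertAt-lookup σ t false))
          ... | inj₂ (i' , refl) with t-or-punchIn j
          ... | inj₁ refl = ⊥-elim (true≢false (source≢ i') (as _ _ Tij))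
          ... | inj₂ (j' , refl) = trans (insertAt-punchIn σ t false j')
                 (isUpClosed⁻-sound σ p i' j' (trans (sym (insertAt-punchIn σ t false i')) σi) Tij)

module Cones where

  open import Data.Bool.Base using (Bool; true; false)
  open import Data.Nat.Base using (ℕ; suc; _∸_; _≤_; _<_; s≤s)
  open import Data.Nat.Properties using (≤-trans; ≤-refl; ≤-pred; ≤-reflexive; ∸-monoˡ-≤; m+[n∸m]≡n; _<?_)
  open import Data.Fin.Base using (Fin; toℕ) renaming (zero to fzero; suc to fsuc)
  open import Data.Fin.Properties using (_≟_; toℕ<n)
  open import Data.Vec.Base using (Vec; lookup)
  open import Data.Product.Base using (Σ; _×_; _,_)
  open import Data.Sum.Base using (_⊎_; inj₁; inj₂)
  open import Data.Empty using (⊥; ⊥-elim)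
  open import Relation.Nullary using (yes; no; ¬_)
  open import Relation.Binary.PropositionalEquality
  open BooleanLists
  open Digraphs
  open Tournaments using (module UpClosure)

  module Cone {n c : ℕ} (R : Fin (suc n) → Fin (suc n) → Bool) (R' : Fin n → Fin n → Bool)
    (ι : Fin c → Fin n) (σ : Vec Bool c)
    (R-suc : ∀ u v → R (fsuc u) (fsuc v) ≡ R' u v)
    (R-loop : R fzero fzero ≡ false)
    (R-out⇒ : ∀ v → R fzero (fsuc v) ≡ true → Σ (Fin c) λ i → ι i ≡ v × lookup σ i ≡ true)
    (R-out⇐ : ∀ i → lookup σ i ≡ true → R fzero (fsuc (ι i)) ≡ true)
    (R-in⇒ : ∀ v → R (fsuc v) fzero ≡ true → Σ (Fin c) λ i → ι i ≡ v × lookup σ i ≡ false)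
    (R-in⇐ : ∀ i → lookup σ i ≡ false → R (fsuc (ι i)) fzero ≡ true)
    where

    module D = Digraph R
    module D' = Digraph R'
    open D using (Path; []; _∷_; _++ᵖ_)
    open D' using () renaming (Path to Path'; [] to []'; _∷_ to _∷'_)
    open UpClosure (λ i j → R' (ι i) (ι j)) using (IsUpClosed)

    IsClique : Set
    IsClique = ∀ i j → ¬ i ≡ j → R' (ι i) (ι j) ≡ true ⊎ R' (ι j) (ι i) ≡ true

    lift : ∀ {L u v} → Path' L u v → Path L (fsuc u) (fsuc v)
    lift []' = []
    lift (_∷'_ {u = u} {w = w} e p) = trans (R-suc u w) e ∷ lift p

    acyclic⇒acyclic' : D.Acyclic → D'.Acyclic
    acyclic⇒acyclic' ac v L p = ac (fsuc v) L (lift p)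

    acyclic⇒upClosed : D.Acyclic → IsUpClosed σ
    acyclic⇒upClosed ac i j σi e with lookup σ j in σj
    ... | true = refl
    ... | false = ⊥-elim (ac fzero 2 (R-out⇐ i σi ∷ (trans (R-suc _ _) e ∷ (R-in⇐ j σj ∷ []))))

    module _ (clique : IsClique) (ac' : D'.Acyclic) (upClosed : IsUpClosed σ) where

      avoidsZero-or-passes : ∀ {L x y} → Path L (fsuc x) (fsuc y) →
        Path' L x y ⊎ (Σ ℕ (λ L₁ → Path (suc L₁) (fsuc x) fzero) × Σ ℕ (λ L₂ → Path L₂ fzero (fsuc y)))
      avoidsZero-or-passes [] = inj₁ []'
      avoidsZero-or-passes (_∷_ {w = fzero} e p) = inj₂ ((0 , e ∷ []) , (_ , p))
      avoidsZero-or-passes {x = x} (_∷_ {w = fsuc z} e p) with avoidsZero-or-passes p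
      ... | inj₁ p' = inj₁ (trans (sym (R-suc x z)) e ∷' p')
      ... | inj₂ ((L₁ , p₁) , r) = inj₂ ((suc L₁ , e ∷ p₁) , r)

      pathIntoZero : ∀ {L x} → Path L (fsuc x) fzero →
        Σ (Fin c) λ j → lookup σ j ≡ false × Σ ℕ λ L' → Path' L' x (ι j)
      pathIntoZero {x = x} (_∷_ {w = fzero} e p) with R-in⇒ x e
      ... | j , refl , σj = j , σj , 0 , []'
      pathIntoZero {x = x} (_∷_ {w = fsuc z} e p) with pathIntoZero p
      ... | j , σj , L' , p' = j , σj , suc L' , (trans (sym (R-suc x z)) e ∷' p')

      noCycleAtZero : ∀ {L} → Path (suc L) fzero fzero → ⊥
      noCycleAtZero (_∷_ {w = fzero} e p) = true≢false e R-loop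
      noCycleAtZero (_∷_ {w = fsuc u} e p) with R-out⇒ u e
      ... | i , refl , σi with pathIntoZero p
      ... | j , σj , L' , p' with i ≟ j
      ... | yes refl = true≢false σi σj
      ... | no i≢j with clique i j i≢j
      ... | inj₁ r = true≢false (upClosed i j σi r) σj
      ... | inj₂ r = ac' (ι j) L' (r ∷' p')

      coneAcyclic : D.Acyclic
      coneAcyclic fzero L p = noCycleAtZero p
      coneAcyclic (fsuc x) L p with avoidsZero-or-passes p
      ... | inj₁ p' = ac' x L p'
      ... | inj₂ ((L₁ , p₁) , (L₂ , e ∷ p₂)) = noCycleAtZero (e ∷ (p₂ ++ᵖ p₁))

    sink⇒sink' : ∀ v → D.isSinkR (fsuc v) ≡ true → D'.isSinkR v ≡ true
    sink⇒sink' v s = D'.noArc⇒isSink v (λ w → trans (sym (R-suc v w)) (D.isSink⇒noArc (fsuc v) s (fsuc w)))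

    module ZeroIsSink (allIn : ∀ i → lookup σ i ≡ false)
                      (toℕ-ι : ∀ i → toℕ (ι i) ≡ toℕ i)
                      (ι-onto : ∀ v → toℕ v < c → Σ (Fin c) λ i → ι i ≡ v)
                      (k : ℕ) (1≤k : 1 ≤ k) (k≤1+c : k ≤ suc c) where

      sinksBelow⇒ : D.SinksBelow k → D'.SinksBelow c
      sinksBelow⇒ sb v sv with toℕ v <? c
      ... | yes h = h
      ... | no h = ⊥-elim (h (≤-pred (≤-trans (sb (fsuc v) (D.noArc⇒isSink (fsuc v) noArc)) k≤1+c)))
        where
        noArc : ∀ w → R (fsuc v) w ≡ false
        noArc (fsuc w) = trans (R-suc v w) (D'.isSink⇒noArc v sv w)
        noArc fzero with R (fsuc v) fzero in eq
        ... | false = refl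
        ... | true with R-in⇒ v eq
        ... | j , refl , _ = ⊥-elim (h (subst (_< c) (sym (toℕ-ι j)) (toℕ<n j)))

      sinksBelow⇐ : D'.SinksBelow c → D.SinksBelow k
      sinksBelow⇐ sb fzero _ = 1≤k
      sinksBelow⇐ sb (fsuc v) s with ι-onto v (sb v (sink⇒sink' v s))
      ... | j , refl = ⊥-elim (true≢false (R-in⇐ j (allIn j)) (D.isSink⇒noArc (fsuc (ι j)) s fzero))

    module ZeroHasOutArc (clique : IsClique) (upClosed : IsUpClosed σ) (i₀ : Fin c) (σi₀ : lookup σ i₀ ≡ true)
                         (k : ℕ) (1≤k : 1 ≤ k) where

      sink'⇒sink : ∀ v → D'.isSinkR v ≡ true → D.isSinkR (fsuc v) ≡ true
      sink'⇒sink v sv = D.noArc⇒isSink (fsuc v) noArc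
        where
        noArc : ∀ w → R (fsuc v) w ≡ false
        noArc (fsuc w) = trans (R-suc v w) (D'.isSink⇒noArc v sv w)
        noArc fzero with R (fsuc v) fzero in eq
        ... | false = refl
        ... | true with R-in⇒ v eq
        ... | j , refl , σj with i₀ ≟ j
        ... | yes refl = ⊥-elim (true≢false σi₀ σj)
        ... | no ne with clique i₀ j ne
        ... | inj₁ r = ⊥-elim (true≢false (upClosed i₀ j σi₀ r) σj)
        ... | inj₂ r = ⊥-elim (true≢false r (D'.isSink⇒noArc (ι j) sv (ι i₀)))

      sinksBelow⇒ : D.SinksBelow k → D'.SinksBelow (k ∸ 1)
      sinksBelow⇒ sb v sv = ≤-trans (s≤s ≤-refl) (∸-monoˡ-≤ 1 (sb (fsuc v) (sink'⇒sink v sv)))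

      sinksBelow⇐ : D'.SinksBelow (k ∸ 1) → D.SinksBelow k
      sinksBelow⇐ sb fzero s = ⊥-elim (true≢false (R-out⇐ i₀ σi₀) (D.isSink⇒noArc fzero s (fsuc (ι i₀))))
      sinksBelow⇐ sb (fsuc v) s = ≤-trans (s≤s (sb v (sink⇒sink' v s))) (≤-reflexive (m+[n∸m]≡n 1≤k))

module SemiringSums where

  open import Level using (Level)
  open import Data.Bool.Base using (Bool; true; false; if_then_else_)
  open import Data.Nat.Base using (ℕ; zero; suc; _<_; z≤n; s≤s) renaming (_+_ to _+ℕ_)
  import Data.Nat.Properties as ℕ
  open import Data.Fin.Base using (Fin; toℕ) renaming (zero to fzero; suc to fsuc)
  open import Data.Vec.Base using (Vec; insertAt; toList) renaming ([] to []ᵥ; _∷_ to _∷ᵥ_)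
  open import Data.List.Base using (List; []; _∷_; map; _++_; applyUpTo; allFin)
  open import Data.List.Properties using (map-++; map-∘; map-applyUpTo)
  open import Data.Product.Base using (_,_)
  open import Function.Base using (_∘_)
  open import Algebra.Bundles using (CommutativeSemiring)
  import Algebra.Properties.CommutativeSemigroup as CommSemigroupProperties
  import Relation.Binary.PropositionalEquality as ≡
  open ≡ using (_≡_)
  open import Defs using (allVecs; module Poly)
  open BooleanLists using (allFin-suc)
  open Tournaments

  module Sums {c ℓ : Level} (S : CommutativeSemiring c ℓ) (q : CommutativeSemiring.Carrier S) where
    open CommutativeSemiring S
    open Poly S
    open import Relation.Binary.Reasoning.Setoid setoid
    open CommSemigroupProperties +-commutativeSemigroup using () renaming (interchange to +-interchange)

    sumL-++ : ∀ xs ys → sumL (xs ++ ys) ≈ sumL xs + sumL ys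
    sumL-++ [] ys = sym (+-identityˡ _)
    sumL-++ (x ∷ xs) ys = trans (+-congˡ (sumL-++ xs ys)) (sym (+-assoc _ _ _))

    sumL-map-cong : ∀ {A : Set} (f g : A → Carrier) → (∀ x → f x ≈ g x) → ∀ xs → sumL (map f xs) ≈ sumL (map g xs)
    sumL-map-cong f g e [] = refl
    sumL-map-cong f g e (x ∷ xs) = +-cong (e x) (sumL-map-cong f g e xs)

    sumVec : (k : ℕ) → (Vec Bool k → Carrier) → Carrier
    sumVec k F = sumL (map F (allVecs k))

    sumVec-cong : ∀ k (F G : Vec Bool k → Carrier) → (∀ σ → F σ ≈ G σ) → sumVec k F ≈ sumVec k G
    sumVec-cong k F G e = sumL-map-cong F G e (allVecs k)

    sumVec-suc : ∀ k (F : Vec Bool (suc k) → Carrier) →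
      sumVec (suc k) F ≈ sumVec k (λ σ → F (true ∷ᵥ σ)) + sumVec k (λ σ → F (false ∷ᵥ σ))
    sumVec-suc k F = begin
      sumL (map F (map (true ∷ᵥ_) (allVecs k) ++ map (false ∷ᵥ_) (allVecs k)))
        ≡⟨ ≡.cong sumL (map-++ F (map (true ∷ᵥ_) (allVecs k)) _) ⟩
      sumL (map F (map (true ∷ᵥ_) (allVecs k)) ++ map F (map (false ∷ᵥ_) (allVecs k)))
        ≈⟨ sumL-++ (map F (map (true ∷ᵥ_) (allVecs k))) (map F (map (false ∷ᵥ_) (allVecs k))) ⟩
      sumL (map F (map (true ∷ᵥ_) (allVecs k))) + sumL (map F (map (false ∷ᵥ_) (allVecs k)))
        ≡⟨ ≡.cong₂ _+_ (≡.cong sumL (≡.sym (map-∘ (allVecs k)))) (≡.cong sumL (≡.sym (map-∘ (allVecs k)))) ⟩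
      sumVec k (λ σ → F (true ∷ᵥ σ)) + sumVec k (λ σ → F (false ∷ᵥ σ)) ∎

    sumVec-insertAt : ∀ k (t : Fin (suc k)) (F : Vec Bool (suc k) → Carrier) →
      sumVec (suc k) F ≈ sumVec k (λ σ → F (insertAt σ t true)) + sumVec k (λ σ → F (insertAt σ t false))
    sumVec-insertAt k fzero F = sumVec-suc k F
    sumVec-insertAt (suc k) (fsuc t) F = begin
      sumVec (suc (suc k)) F ≈⟨ sumVec-suc (suc k) F ⟩
      sumVec (suc k) (λ σ → F (true ∷ᵥ σ)) + sumVec (suc k) (λ σ → F (false ∷ᵥ σ))
        ≈⟨ +-cong (sumVec-insertAt k t (λ σ → F (true ∷ᵥ σ))) (sumVec-insertAt k t (λ σ → F (false ∷ᵥ σ))) ⟩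
      (sumVec k (λ σ → F (true ∷ᵥ insertAt σ t true)) + sumVec k (λ σ → F (true ∷ᵥ insertAt σ t false)))
       + (sumVec k (λ σ → F (false ∷ᵥ insertAt σ t true)) + sumVec k (λ σ → F (false ∷ᵥ insertAt σ t false)))
        ≈⟨ +-interchange _ _ _ _ ⟩
      (sumVec k (λ σ → F (true ∷ᵥ insertAt σ t true)) + sumVec k (λ σ → F (false ∷ᵥ insertAt σ t true)))
       + (sumVec k (λ σ → F (true ∷ᵥ insertAt σ t false)) + sumVec k (λ σ → F (false ∷ᵥ insertAt σ t false)))
        ≈⟨ sym (+-cong (sumVec-suc k (λ σ → F (insertAt σ (fsuc t) true)))
                       (sumVec-suc k (λ σ → F (insertAt σ (fsuc t) false)))) ⟩
      sumVec (suc k) (λ σ → F (insertAt σ (fsuc t) true)) + sumVec (suc k) (λ σ → F (insertAt σ (fsuc t) false)) ∎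

    sumVec-0# : ∀ k → sumVec k (λ _ → 0#) ≈ 0#
    sumVec-0# zero = +-identityʳ 0#
    sumVec-0# (suc k) = trans (sumVec-suc k (λ _ → 0#)) (trans (+-cong (sumVec-0# k) (sumVec-0# k)) (+-identityʳ 0#))

    sumVec-allTrue : ∀ k z → sumVec k (λ σ → if allTrue σ then z else 0#) ≈ z
    sumVec-allTrue zero z = +-identityʳ z
    sumVec-allTrue (suc k) z = begin
      sumVec (suc k) (λ σ → if allTrue σ then z else 0#) ≈⟨ sumVec-suc k _ ⟩
      sumVec k (λ σ → if allTrue σ then z else 0#) + sumVec k (λ σ → 0#) ≈⟨ +-cong (sumVec-allTrue k z) (sumVec-0# k) ⟩
      z + 0# ≈⟨ +-identityʳ z ⟩
      z ∎

    sumVec-+ : ∀ k (F H : Vec Bool k → Carrier) → sumVec k (λ σ → F σ + H σ) ≈ sumVec k F + sumVec k H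
    sumVec-+ zero F H = begin
      (F []ᵥ + H []ᵥ) + 0# ≈⟨ +-identityʳ _ ⟩
      F []ᵥ + H []ᵥ ≈⟨ sym (+-cong (+-identityʳ _) (+-identityʳ _)) ⟩
      (F []ᵥ + 0#) + (H []ᵥ + 0#) ∎
    sumVec-+ (suc k) F H = begin
      sumVec (suc k) (λ σ → F σ + H σ) ≈⟨ sumVec-suc k _ ⟩
      sumVec k (λ σ → F (true ∷ᵥ σ) + H (true ∷ᵥ σ)) + sumVec k (λ σ → F (false ∷ᵥ σ) + H (false ∷ᵥ σ))
        ≈⟨ +-cong (sumVec-+ k _ _) (sumVec-+ k _ _) ⟩
      (sumVec k (λ σ → F (true ∷ᵥ σ)) + sumVec k (λ σ → H (true ∷ᵥ σ)))
       + (sumVec k (λ σ → F (false ∷ᵥ σ)) + sumVec k (λ σ → H (false ∷ᵥ σ)))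
        ≈⟨ +-interchange _ _ _ _ ⟩
      (sumVec k (λ σ → F (true ∷ᵥ σ)) + sumVec k (λ σ → F (false ∷ᵥ σ)))
       + (sumVec k (λ σ → H (true ∷ᵥ σ)) + sumVec k (λ σ → H (false ∷ᵥ σ)))
        ≈⟨ sym (+-cong (sumVec-suc k F) (sumVec-suc k H)) ⟩
      sumVec (suc k) F + sumVec (suc k) H ∎

    sumVec-*ˡ : ∀ k z (F : Vec Bool k → Carrier) → sumVec k (λ σ → z * F σ) ≈ z * sumVec k F
    sumVec-*ˡ zero z F = trans (+-congˡ (sym (zeroʳ z))) (sym (distribˡ z _ _))
    sumVec-*ˡ (suc k) z F = begin
      sumVec (suc k) (λ σ → z * F σ) ≈⟨ sumVec-suc k _ ⟩
      sumVec k (λ σ → z * F (true ∷ᵥ σ)) + sumVec k (λ σ → z * F (false ∷ᵥ σ)) ≈⟨ +-cong (sumVec-*ˡ k z _) (sumVec-*ˡ k z _) ⟩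
      z * sumVec k (λ σ → F (true ∷ᵥ σ)) + z * sumVec k (λ σ → F (false ∷ᵥ σ)) ≈⟨ sym (distribˡ z _ _) ⟩
      z * (sumVec k (λ σ → F (true ∷ᵥ σ)) + sumVec k (λ σ → F (false ∷ᵥ σ))) ≈⟨ *-congˡ (sym (sumVec-suc k F)) ⟩
      z * sumVec (suc k) F ∎

    sumVec-++ : ∀ k l (F : List Bool → Carrier) →
      sumVec (k +ℕ l) (F ∘ toList) ≈ sumVec k (λ σ → sumVec l (λ ρ → F (toList σ ++ toList ρ)))
    sumVec-++ zero l F = sym (+-identityʳ _)
    sumVec-++ (suc k) l F = begin
      sumVec (suc (k +ℕ l)) (F ∘ toList) ≈⟨ sumVec-suc (k +ℕ l) _ ⟩
      sumVec (k +ℕ l) ((F ∘ (true ∷_)) ∘ toList) + sumVec (k +ℕ l) ((F ∘ (false ∷_)) ∘ toList)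
        ≈⟨ +-cong (sumVec-++ k l (F ∘ (true ∷_))) (sumVec-++ k l (F ∘ (false ∷_))) ⟩
      _ ≈⟨ sym (sumVec-suc k _) ⟩
      sumVec (suc k) (λ σ → sumVec l (λ ρ → F (toList σ ++ toList ρ))) ∎

    sumVec-swap : ∀ k l (H : Vec Bool k → Vec Bool l → Carrier) →
      sumVec k (λ σ → sumVec l (λ ρ → H σ ρ)) ≈ sumVec l (λ ρ → sumVec k (λ σ → H σ ρ))
    sumVec-swap zero l H = trans (+-identityʳ _) (sumVec-cong l _ _ (λ ρ → sym (+-identityʳ _)))
    sumVec-swap (suc k) l H = begin
      sumVec (suc k) (λ σ → sumVec l (λ ρ → H σ ρ)) ≈⟨ sumVec-suc k _ ⟩
      sumVec k (λ σ → sumVec l (λ ρ → H (true ∷ᵥ σ) ρ)) + sumVec k (λ σ → sumVec l (λ ρ → H (false ∷ᵥ σ) ρ))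
        ≈⟨ +-cong (sumVec-swap k l _) (sumVec-swap k l _) ⟩
      sumVec l (λ ρ → sumVec k (λ σ → H (true ∷ᵥ σ) ρ)) + sumVec l (λ ρ → sumVec k (λ σ → H (false ∷ᵥ σ) ρ))
        ≈⟨ sym (sumVec-+ l _ _) ⟩
      sumVec l (λ ρ → sumVec k (λ σ → H (true ∷ᵥ σ) ρ) + sumVec k (λ σ → H (false ∷ᵥ σ) ρ))
        ≈⟨ sumVec-cong l _ _ (λ ρ → sym (sumVec-suc k (λ σ → H σ ρ))) ⟩
      sumVec l (λ ρ → sumVec (suc k) (λ σ → H σ ρ)) ∎

    pow-+ : ∀ m n → pow q (m +ℕ n) ≈ pow q m * pow q n
    pow-+ zero n = sym (*-identityˡ _)
    pow-+ (suc m) n = trans (*-congˡ (pow-+ m n)) (sym (*-assoc _ _ _))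

    sumUpTo : (ℕ → Carrier) → ℕ → Carrier
    sumUpTo h n = sumL (applyUpTo h n)

    qint≡sumUpTo : ∀ n → qint q n ≡ sumUpTo (pow q) n
    qint≡sumUpTo n = ≡.cong sumL (map-applyUpTo (λ x → x) (pow q) n)

    sumUpTo-*ˡ : ∀ (h : ℕ → Carrier) n → sumUpTo (λ i → q * h i) n ≈ q * sumUpTo h n
    sumUpTo-*ˡ h zero = sym (zeroʳ q)
    sumUpTo-*ˡ h (suc n) = trans (+-congˡ (sumUpTo-*ˡ (h ∘ suc) n)) (sym (distribˡ q (h 0) _))

    sumUpTo-suc : ∀ (h : ℕ → Carrier) n → sumUpTo h (suc n) ≈ sumUpTo h n + h n
    sumUpTo-suc h zero = trans (+-identityʳ _) (sym (+-identityˡ _))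
    sumUpTo-suc h (suc n) = trans (+-congˡ (sumUpTo-suc (h ∘ suc) n)) (sym (+-assoc _ _ _))

    qint-suc : ∀ n → qint q (suc n) ≈ 1# + q * qint q n
    qint-suc n = begin
      qint q (suc n) ≡⟨ qint≡sumUpTo (suc n) ⟩
      1# + sumUpTo (λ i → q * pow q i) n ≈⟨ +-congˡ (sumUpTo-*ˡ (pow q) n) ⟩
      1# + q * sumUpTo (pow q) n ≡⟨ ≡.cong (λ z → 1# + q * z) (≡.sym (qint≡sumUpTo n)) ⟩
      1# + q * qint q n ∎

    qint-sucʳ : ∀ n → qint q (suc n) ≈ qint q n + pow q n
    qint-sucʳ n = begin
      qint q (suc n) ≡⟨ qint≡sumUpTo (suc n) ⟩
      sumUpTo (pow q) (suc n) ≈⟨ sumUpTo-suc (pow q) n ⟩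
      sumUpTo (pow q) n + pow q n ≡⟨ ≡.cong (_+ pow q n) (≡.sym (qint≡sumUpTo n)) ⟩
      qint q n + pow q n ∎

    prodUpTo : (ℕ → Carrier) → ℕ → Carrier
    prodUpTo h m = prodL (map (h ∘ toℕ) (allFin m))

    prodUpTo-suc : ∀ h m → prodUpTo h (suc m) ≡ h 0 * prodUpTo (h ∘ suc) m
    prodUpTo-suc h m = ≡.trans (≡.cong (prodL ∘ map (h ∘ toℕ)) (allFin-suc m))
                               (≡.cong (λ z → h 0 * prodL z) (≡.sym (map-∘ (allFin m))))

    prodUpTo-cong : ∀ m h g → (∀ n → n < m → h n ≈ g n) → prodUpTo h m ≈ prodUpTo g m
    prodUpTo-cong zero h g e = refl
    prodUpTo-cong (suc m) h g e = begin
      prodUpTo h (suc m) ≡⟨ prodUpTo-suc h m ⟩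
      h 0 * prodUpTo (h ∘ suc) m ≈⟨ *-cong (e 0 (s≤s z≤n)) (prodUpTo-cong m (h ∘ suc) (g ∘ suc) (λ n l → e (suc n) (s≤s l))) ⟩
      g 0 * prodUpTo (g ∘ suc) m ≡⟨ ≡.sym (prodUpTo-suc g m) ⟩
      prodUpTo g (suc m) ∎

    prodUpTo-+ : ∀ x y h → prodUpTo h (x +ℕ y) ≈ prodUpTo h x * prodUpTo (λ n → h (x +ℕ n)) y
    prodUpTo-+ zero y h = sym (*-identityˡ _)
    prodUpTo-+ (suc x) y h = begin
      prodUpTo h (suc (x +ℕ y)) ≡⟨ prodUpTo-suc h (x +ℕ y) ⟩
      h 0 * prodUpTo (h ∘ suc) (x +ℕ y) ≈⟨ *-congˡ (prodUpTo-+ x y (h ∘ suc)) ⟩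
      h 0 * (prodUpTo (h ∘ suc) x * prodUpTo (λ n → h (suc (x +ℕ n))) y) ≈⟨ sym (*-assoc _ _ _) ⟩
      (h 0 * prodUpTo (h ∘ suc) x) * prodUpTo (λ n → h (suc (x +ℕ n))) y
        ≡⟨ ≡.cong (_* prodUpTo (λ n → h (suc (x +ℕ n))) y) (≡.sym (prodUpTo-suc h x)) ⟩
      prodUpTo h (suc x) * prodUpTo (λ n → h (suc x +ℕ n)) y ∎

    qFactorial : ℕ → Carrier
    qFactorial = prodUpTo (λ n → qint q (suc n))

    qFactorial-suc : ∀ n → qFactorial (suc n) ≈ qFactorial n * qint q (suc n)
    qFactorial-suc n = begin
      qFactorial (suc n) ≡⟨ ≡.cong qFactorial (ℕ.+-comm 1 n) ⟩
      qFactorial (n +ℕ 1) ≈⟨ prodUpTo-+ n 1 (λ n → qint q (suc n)) ⟩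
      qFactorial n * (qint q (suc (n +ℕ 0)) * 1#) ≈⟨ *-congˡ (*-identityʳ _) ⟩
      qFactorial n * qint q (suc (n +ℕ 0)) ≡⟨ ≡.cong (λ z → qFactorial n * qint q (suc z)) (ℕ.+-identityʳ n) ⟩
      qFactorial n * qint q (suc n) ∎

    -- An up-closed set of a transitive tournament on k vertices is a final segment of
    -- its linear order; weighting the empty one by x and a nonempty one of size s by q^s y gives
    upClosedSum : ∀ k (T : Fin k → Fin k → Bool) → Total T → Asymmetric T → Transitive T → ∀ x y →
      sumVec k (λ σ → if UpClosure.isUpClosed T σ
                      then (if allFalse σ then x else pow q (trueCount σ) * y) else 0#)
        ≈ x + (q * qint q k) * y
    upClosedSum zero T tot as tr x y = begin
      x + 0# ≈⟨ +-congˡ (sym (trans (*-congʳ (zeroʳ q)) (zeroˡ y))) ⟩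
      x + (q * 0#) * y ∎
    upClosedSum (suc k) T tot as tr x y with source T tot tr
    ... | t , t-source = begin
      sumVec (suc k) term ≈⟨ sumVec-insertAt k t term ⟩
      sumVec k (λ σ → term (insertAt σ t true)) + sumVec k (λ σ → term (insertAt σ t false))
        ≈⟨ +-cong (sumVec-cong k _ _ withSource) (sumVec-cong k _ _ withoutSource) ⟩
      sumVec k (λ σ → if allTrue σ then pow q (suc k) * y else 0#) + sumVec k term⁻
        ≈⟨ +-cong (sumVec-allTrue k _) (upClosedSum k T⁻ (total⁻ tot) (asymmetric⁻ as) (transitive⁻ tr) x y) ⟩
      pow q (suc k) * y + (x + (q * qint q k) * y) ≈⟨ +-comm _ _ ⟩
      (x + (q * qint q k) * y) + pow q (suc k) * y ≈⟨ +-assoc _ _ _ ⟩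
      x + ((q * qint q k) * y + pow q (suc k) * y) ≈⟨ +-congˡ (sym (distribʳ y _ _)) ⟩
      x + ((q * qint q k + q * pow q k) * y) ≈⟨ +-congˡ (*-congʳ (sym (distribˡ q _ _))) ⟩
      x + ((q * (qint q k + pow q k)) * y) ≈⟨ +-congˡ (*-congʳ (*-congˡ (sym (qint-sucʳ k)))) ⟩
      x + (q * qint q (suc k)) * y ∎
      where
      open DeleteVertex T t
      term : Vec Bool (suc k) → Carrier
      term σ = if UpClosure.isUpClosed T σ then (if allFalse σ then x else pow q (trueCount σ) * y) else 0#
      term⁻ : Vec Bool k → Carrier
      term⁻ σ = if UpClosure.isUpClosed T⁻ σ then (if allFalse σ then x else pow q (trueCount σ) * y) else 0#
      withSource : ∀ σ → term (insertAt σ t true) ≈ (if allTrue σ then pow q (suc k) * y else 0#)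
      withSource σ rewrite isUpClosed-insertTrue t-source σ | allFalse-insertAt σ t true
                         | trueCount-insertAt σ t true with allTrue σ in σ-allTrue
      ... | true rewrite allTrue⇒trueCount≡length σ σ-allTrue = refl
      ... | false = refl
      withoutSource : ∀ σ → term (insertAt σ t false) ≈ term⁻ σ
      withoutSource σ rewrite isUpClosed-insertFalse t-source as σ | allFalse-insertAt σ t false
                            | trueCount-insertAt σ t false = refl

module EdgeLists where

  open import Data.Bool.Base using (true; _∧_)
  open import Data.Nat.Base using (ℕ; zero; suc; _+_; _<_; _⊓_; _<ᵇ_)
  open import Data.Fin.Base using (Fin; toℕ; fromℕ<) renaming (zero to fzero; suc to fsuc)
  open import Data.Fin.Properties using (toℕ-injective; toℕ-fromℕ<)
  open import Data.List.Base using (List; _∷_; map; allFin; _++_; length; concat; filterᵇ)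
  open import Data.List.Properties using (map-∘; map-cong; length-map; length-++; length-tabulate; concat-map)
  open import Data.List.Membership.Propositional using (_∈_)
  open import Data.List.Membership.Propositional.Properties using (∈-allFin; ∈-map⁺; ∈-concat⁺′)
  open import Data.Product.Base using (Σ; _×_; _,_; proj₁; proj₂)
  open import Function.Base using (_∘_)
  open import Relation.Binary.PropositionalEquality
  open import Defs using (isEdge; edges)
  open BooleanLists

  inject⊓ : ∀ d m → Fin (d ⊓ m) → Fin m
  inject⊓ (suc d) (suc m) fzero = fzero
  inject⊓ (suc d) (suc m) (fsuc i) = fsuc (inject⊓ d m i)

  toℕ-inject⊓ : ∀ d m (i : Fin (d ⊓ m)) → toℕ (inject⊓ d m i) ≡ toℕ i
  toℕ-inject⊓ (suc d) (suc m) fzero = refl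
  toℕ-inject⊓ (suc d) (suc m) (fsuc i) = cong suc (toℕ-inject⊓ d m i)

  inject⊓-onto : ∀ d m (v : Fin m) → toℕ v < d ⊓ m → Σ (Fin (d ⊓ m)) λ i → inject⊓ d m i ≡ v
  inject⊓-onto d m v h = fromℕ< h , toℕ-injective (trans (toℕ-inject⊓ d m _) (toℕ-fromℕ< h))

  filterᵇ-toℕ<ᵇ : ∀ d m → filterᵇ (λ j → toℕ j <ᵇ d) (allFin m) ≡ map (inject⊓ d m) (allFin (d ⊓ m))
  filterᵇ-toℕ<ᵇ zero zero = refl
  filterᵇ-toℕ<ᵇ (suc d) zero = refl
  filterᵇ-toℕ<ᵇ zero (suc m) = filterᵇ-none _ (λ _ → refl) (allFin (suc m))
  filterᵇ-toℕ<ᵇ (suc d) (suc m) = begin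
    filterᵇ (λ j → toℕ j <ᵇ suc d) (allFin (suc m)) ≡⟨ cong (filterᵇ (λ j → toℕ j <ᵇ suc d)) (allFin-suc m) ⟩
    fzero ∷ filterᵇ (λ j → toℕ j <ᵇ suc d) (map fsuc (allFin m)) ≡⟨ cong (fzero ∷_) (filterᵇ-map _ fsuc (allFin m)) ⟩
    fzero ∷ map fsuc (filterᵇ (λ j → toℕ j <ᵇ d) (allFin m)) ≡⟨ cong (λ z → fzero ∷ map fsuc z) (filterᵇ-toℕ<ᵇ d m) ⟩
    fzero ∷ map fsuc (map (inject⊓ d m) (allFin (d ⊓ m))) ≡⟨ cong (fzero ∷_) (sym (map-∘ (allFin (d ⊓ m)))) ⟩
    fzero ∷ map (inject⊓ (suc d) (suc m) ∘ fsuc) (allFin (d ⊓ m)) ≡⟨ cong (fzero ∷_) (map-∘ (allFin (d ⊓ m))) ⟩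
    fzero ∷ map (inject⊓ (suc d) (suc m)) (map fsuc (allFin (d ⊓ m)))
      ≡⟨ cong (map (inject⊓ (suc d) (suc m))) (sym (allFin-suc (d ⊓ m))) ⟩
    map (inject⊓ (suc d) (suc m)) (allFin (suc (d ⊓ m))) ∎
    where open ≡-Reasoning

  edgesFrom : ∀ {m} (a : Fin (suc m) → ℕ) → Fin (suc m) → List (Fin (suc m) × Fin (suc m))
  edgesFrom {m} a i = map (λ j → (i , j)) (filterᵇ (isEdge a i) (allFin (suc m)))

  shift : ∀ {m} → Fin m × Fin m → Fin (suc m) × Fin (suc m)
  shift e = fsuc (proj₁ e) , fsuc (proj₂ e)

  edgesFromFirst : ∀ {m} (a : Fin (suc (suc m)) → ℕ) → List (Fin (suc (suc m)) × Fin (suc (suc m)))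
  edgesFromFirst {m} a = map (λ i → (fzero , fsuc (inject⊓ (a fzero) (suc m) i))) (allFin (a fzero ⊓ suc m))

  isEdge-suc : ∀ {m} (a : Fin (suc (suc m)) → ℕ) i j → isEdge a (fsuc i) (fsuc j) ≡ isEdge (a ∘ fsuc) i j
  isEdge-suc a i j = cong ((toℕ i <ᵇ toℕ j) ∧_) (<ᵇ-suc (toℕ j) (toℕ i + a (fsuc i)))

  edgesFrom-zero : ∀ {m} (a : Fin (suc (suc m)) → ℕ) → edgesFrom a fzero ≡ edgesFromFirst a
  edgesFrom-zero {m} a = begin
    map (λ j → (fzero , j)) (filterᵇ (isEdge a fzero) (allFin (suc (suc m))))
      ≡⟨ cong (λ z → map (λ j → (fzero , j)) (filterᵇ (isEdge a fzero) z)) (allFin-suc (suc m)) ⟩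
    map (λ j → (fzero , j)) (filterᵇ (isEdge a fzero) (map fsuc (allFin (suc m))))
      ≡⟨ cong (map (λ j → (fzero , j))) (filterᵇ-map (isEdge a fzero) fsuc (allFin (suc m))) ⟩
    map (λ j → (fzero , j)) (map fsuc (filterᵇ (λ j → toℕ j <ᵇ a fzero) (allFin (suc m))))
      ≡⟨ cong (λ z → map (λ j → (fzero , j)) (map fsuc z)) (filterᵇ-toℕ<ᵇ (a fzero) (suc m)) ⟩
    map (λ j → (fzero , j)) (map fsuc (map (inject⊓ (a fzero) (suc m)) (allFin (a fzero ⊓ suc m))))
      ≡⟨ cong (map (λ j → (fzero , j))) (sym (map-∘ (allFin (a fzero ⊓ suc m)))) ⟩
    map (λ j → (fzero , j)) (map (fsuc ∘ inject⊓ (a fzero) (suc m)) (allFin (a fzero ⊓ suc m)))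
      ≡⟨ sym (map-∘ (allFin (a fzero ⊓ suc m))) ⟩
    edgesFromFirst a ∎
    where open ≡-Reasoning

  edgesFrom-suc : ∀ {m} (a : Fin (suc (suc m)) → ℕ) i → edgesFrom a (fsuc i) ≡ map shift (edgesFrom (a ∘ fsuc) i)
  edgesFrom-suc {m} a i = begin
    map (λ j → (fsuc i , j)) (filterᵇ (isEdge a (fsuc i)) (allFin (suc (suc m))))
      ≡⟨ cong (λ z → map (λ j → (fsuc i , j)) (filterᵇ (isEdge a (fsuc i)) z)) (allFin-suc (suc m)) ⟩
    map (λ j → (fsuc i , j)) (filterᵇ (isEdge a (fsuc i)) (map fsuc (allFin (suc m))))
      ≡⟨ cong (map (λ j → (fsuc i , j))) (filterᵇ-map (isEdge a (fsuc i)) fsuc (allFin (suc m))) ⟩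
    map (λ j → (fsuc i , j)) (map fsuc (filterᵇ (isEdge a (fsuc i) ∘ fsuc) (allFin (suc m))))
      ≡⟨ cong (λ z → map (λ j → (fsuc i , j)) (map fsuc z)) (filterᵇ-cong _ _ (isEdge-suc a i) (allFin (suc m))) ⟩
    map (λ j → (fsuc i , j)) (map fsuc (filterᵇ (isEdge (a ∘ fsuc) i) (allFin (suc m))))
      ≡⟨ sym (map-∘ (filterᵇ (isEdge (a ∘ fsuc) i) (allFin (suc m)))) ⟩
    map (λ j → (fsuc i , fsuc j)) (filterᵇ (isEdge (a ∘ fsuc) i) (allFin (suc m)))
      ≡⟨ map-∘ (filterᵇ (isEdge (a ∘ fsuc) i) (allFin (suc m))) ⟩
    map shift (edgesFrom (a ∘ fsuc) i) ∎
    where open ≡-Reasoning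

  edges-split : ∀ {m} (a : Fin (suc (suc m)) → ℕ) → edges a ≡ edgesFromFirst a ++ map shift (edges (a ∘ fsuc))
  edges-split {m} a = begin
    concat (map (edgesFrom a) (allFin (suc (suc m)))) ≡⟨ cong (λ z → concat (map (edgesFrom a) z)) (allFin-suc (suc m)) ⟩
    edgesFrom a fzero ++ concat (map (edgesFrom a) (map fsuc (allFin (suc m))))
      ≡⟨ cong₂ _++_ (edgesFrom-zero a) (cong concat (sym (map-∘ (allFin (suc m))))) ⟩
    edgesFromFirst a ++ concat (map (edgesFrom a ∘ fsuc) (allFin (suc m)))
      ≡⟨ cong (λ z → edgesFromFirst a ++ concat z) (map-cong (edgesFrom-suc a) (allFin (suc m))) ⟩
    edgesFromFirst a ++ concat (map (map shift ∘ edgesFrom (a ∘ fsuc)) (allFin (suc m)))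
      ≡⟨ cong (λ z → edgesFromFirst a ++ concat z) (map-∘ (allFin (suc m))) ⟩
    edgesFromFirst a ++ concat (map (map shift) (map (edgesFrom (a ∘ fsuc)) (allFin (suc m))))
      ≡⟨ cong (edgesFromFirst a ++_) (concat-map (map (edgesFrom (a ∘ fsuc)) (allFin (suc m)))) ⟩
    edgesFromFirst a ++ map shift (edges (a ∘ fsuc)) ∎
    where open ≡-Reasoning

  length-edgesFromFirst : ∀ {m} (a : Fin (suc (suc m)) → ℕ) → length (edgesFromFirst a) ≡ a fzero ⊓ suc m
  length-edgesFromFirst {m} a = trans (length-map _ (allFin (a fzero ⊓ suc m))) (length-tabulate (λ x → x))

  length-edges : ∀ {m} (a : Fin (suc (suc m)) → ℕ) →
                 length (edges a) ≡ (a fzero ⊓ suc m) + length (edges (a ∘ fsuc))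
  length-edges a = begin
    length (edges a) ≡⟨ cong length (edges-split a) ⟩
    length (edgesFromFirst a ++ map shift (edges (a ∘ fsuc))) ≡⟨ length-++ (edgesFromFirst a) ⟩
    length (edgesFromFirst a) + length (map shift (edges (a ∘ fsuc)))
      ≡⟨ cong₂ _+_ (length-edgesFromFirst a) (length-map shift (edges (a ∘ fsuc))) ⟩
    (a fzero ⊓ _) + length (edges (a ∘ fsuc)) ∎
    where open ≡-Reasoning

  isEdge⇒∈edges : ∀ {m} (a : Fin (suc m) → ℕ) x y → isEdge a x y ≡ true → (x , y) ∈ edges a
  isEdge⇒∈edges {m} a x y e =
    ∈-concat⁺′ (∈-map⁺ (λ j → (x , j)) (∈-filterᵇ⁺ (isEdge a x) (∈-allFin y) e)) (∈-map⁺ (edgesFrom a) (∈-allFin x))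

module Orientations where

  open import Data.Bool.Base using (Bool; true; false; _∧_; _∨_; not)
  open import Data.Bool.Properties using (∨-identityʳ; ∧-zeroʳ; ∨-zeroʳ)
  open import Data.Nat.Base using (ℕ; suc; _⊓_)
  open import Data.Fin.Base using (Fin) renaming (zero to fzero; suc to fsuc)
  open import Data.List.Base using (List; _∷_; map; allFin; _++_; length; zip)
  open import Data.Vec.Base using (Vec; toList; lookup) renaming (_∷_ to _∷ᵥ_)
  open import Data.Vec.Properties using (length-toList)
  open import Data.Bool.ListAction using (any)
  open import Data.List.Membership.Propositional.Properties using ()
  open import Data.Product.Base using (Σ; _×_; _,_; proj₁; proj₂)
  open import Data.Sum.Base using (_⊎_; inj₁; inj₂)
  open import Function.Base using (_∘_)
  open import Relation.Binary.PropositionalEquality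
  open import Defs
  open BooleanLists
  open Digraphs
  open EdgeLists

  arcAlong : ∀ {n} → Fin n → Fin n → (Fin n × Fin n) × Bool → Bool
  arcAlong u v ((i , j) , b) = (eqᵇ i u ∧ eqᵇ j v ∧ b) ∨ (eqᵇ i v ∧ eqᵇ j u ∧ not b)

  -- Defs.arc for bit lists of any length, so that they can be split as σ ++ ρ
  arcL : ∀ {m} (a : Fin (suc m) → ℕ) → List Bool → Fin (suc m) → Fin (suc m) → Bool
  arcL a bs u v = any (arcAlong u v) (zip (edges a) bs)

  arc≡arcL : ∀ {m} (a : Fin (suc m) → ℕ) (θ : Orientation a) u v → arc a θ u v ≡ arcL a (toList θ) u v
  arc≡arcL a θ u v = any-cong _ (arcAlong u v) (λ _ → refl) (zip (edges a) (toList θ))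

  arcL-total : ∀ {m} (a : Fin (suc m) → ℕ) bs x y → isEdge a x y ≡ true → length bs ≡ length (edges a) →
               arcL a bs x y ≡ true ⊎ arcL a bs y x ≡ true
  arcL-total a bs x y e l with ∈-zipˡ bs (isEdge⇒∈edges a x y e) (sym l)
  ... | true , m = inj₁ (any≡true⁺ (arcAlong x y) m forward)
    where
    forward : arcAlong x y ((x , y) , true) ≡ true
    forward rewrite eqᵇ-refl x | eqᵇ-refl y = refl
  ... | false , m = inj₂ (any≡true⁺ (arcAlong y x) m backward)
    where
    backward : arcAlong y x ((x , y) , false) ≡ true
    backward rewrite eqᵇ-refl x | eqᵇ-refl y = ∨-zeroʳ _

  any-zipAllFin-suc : ∀ {c} (h : Fin (suc c) → Bool → Bool) x (σ : Vec Bool c) →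
    any (λ p → h (proj₁ p) (proj₂ p)) (zip (allFin (suc c)) (toList (x ∷ᵥ σ))) ≡
    h fzero x ∨ any (λ p → h (fsuc (proj₁ p)) (proj₂ p)) (zip (allFin c) (toList σ))
  any-zipAllFin-suc {c} h x σ = begin
    any (λ p → h (proj₁ p) (proj₂ p)) (zip (allFin (suc c)) (x ∷ toList σ))
      ≡⟨ cong (λ z → any (λ p → h (proj₁ p) (proj₂ p)) (zip z (x ∷ toList σ))) (allFin-suc c) ⟩
    h fzero x ∨ any (λ p → h (proj₁ p) (proj₂ p)) (zip (map fsuc (allFin c)) (toList σ))
      ≡⟨ cong (λ z → h fzero x ∨ any (λ p → h (proj₁ p) (proj₂ p)) z) (zip-mapˡ fsuc (allFin c) (toList σ)) ⟩
    h fzero x ∨ any (λ p → h (proj₁ p) (proj₂ p)) (map _ (zip (allFin c) (toList σ)))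
      ≡⟨ cong (h fzero x ∨_) (any-map _ _ (zip (allFin c) (toList σ))) ⟩
    h fzero x ∨ any (λ p → h (fsuc (proj₁ p)) (proj₂ p)) (zip (allFin c) (toList σ)) ∎
    where open ≡-Reasoning

  any-zipAllFin⁻ : ∀ {c} (h : Fin c → Bool → Bool) (σ : Vec Bool c) →
    any (λ p → h (proj₁ p) (proj₂ p)) (zip (allFin c) (toList σ)) ≡ true → Σ (Fin c) λ i → h i (lookup σ i) ≡ true
  any-zipAllFin⁻ {suc c} h (x ∷ᵥ σ) e with ∨≡true⇒ (trans (sym (any-zipAllFin-suc h x σ)) e)
  ... | inj₁ q = fzero , q
  ... | inj₂ q with any-zipAllFin⁻ (λ i → h (fsuc i)) σ q
  ... | i , r = fsuc i , r

  any-zipAllFin⁺ : ∀ {c} (h : Fin c → Bool → Bool) (σ : Vec Bool c) i → h i (lookup σ i) ≡ true →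
    any (λ p → h (proj₁ p) (proj₂ p)) (zip (allFin c) (toList σ)) ≡ true
  any-zipAllFin⁺ {suc c} h (x ∷ᵥ σ) fzero q =
    trans (any-zipAllFin-suc h x σ) (cong (_∨ any (λ p → h (fsuc (proj₁ p)) (proj₂ p)) (zip (allFin c) (toList σ))) q)
  any-zipAllFin⁺ {suc c} h (x ∷ᵥ σ) (fsuc i) q =
    trans (any-zipAllFin-suc h x σ) (trans (cong (h fzero x ∨_) (any-zipAllFin⁺ (λ i → h (fsuc i)) σ i q)) (∨-zeroʳ _))

  -- The bit list of an orientation of Γ_a splits as σ ++ ρ: σ orients the edges at the first
  -- vertex and ρ is an orientation of Γ_{a ∘ fsuc} on the remaining vertices.
  module FirstVertex {m : ℕ} (a : Fin (suc (suc m)) → ℕ) where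
    c : ℕ
    c = a fzero ⊓ suc m

    a' : Fin (suc m) → ℕ
    a' = a ∘ fsuc

    ι : Fin c → Fin (suc m)
    ι = inject⊓ (a fzero) (suc m)

    arcL-++ : ∀ (σ : Vec Bool c) ρ u v → arcL a (toList σ ++ ρ) u v ≡
       any (λ p → arcAlong u v ((fzero , fsuc (ι (proj₁ p))) , proj₂ p)) (zip (allFin c) (toList σ))
       ∨ any (λ p → arcAlong u v (shift (proj₁ p) , proj₂ p)) (zip (edges a') ρ)
    arcL-++ σ ρ u v = begin
      any (arcAlong u v) (zip (edges a) (toList σ ++ ρ))
        ≡⟨ cong (λ z → any (arcAlong u v) (zip z (toList σ ++ ρ))) (edges-split a) ⟩
      any (arcAlong u v) (zip (edgesFromFirst a ++ map shift (edges a')) (toList σ ++ ρ))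
        ≡⟨ cong (any (arcAlong u v)) (zip-++ (edgesFromFirst a) _ (toList σ) ρ
                                        (trans (length-edgesFromFirst a) (sym (length-toList σ)))) ⟩
      any (arcAlong u v) (zip (edgesFromFirst a) (toList σ) ++ zip (map shift (edges a')) ρ)
        ≡⟨ any-++ (arcAlong u v) (zip (edgesFromFirst a) (toList σ)) (zip (map shift (edges a')) ρ) ⟩
      any (arcAlong u v) (zip (edgesFromFirst a) (toList σ)) ∨ any (arcAlong u v) (zip (map shift (edges a')) ρ)
        ≡⟨ cong₂ _∨_ (cong (any (arcAlong u v)) (zip-mapˡ _ (allFin c) (toList σ)))
                     (cong (any (arcAlong u v)) (zip-mapˡ shift (edges a') ρ)) ⟩
      any (arcAlong u v) (map _ (zip (allFin c) (toList σ))) ∨ any (arcAlong u v) (map _ (zip (edges a') ρ))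
        ≡⟨ cong₂ _∨_ (any-map (arcAlong u v) _ (zip (allFin c) (toList σ))) (any-map (arcAlong u v) _ (zip (edges a') ρ)) ⟩
      _ ∎
      where open ≡-Reasoning

    arcL-suc-suc : ∀ (σ : Vec Bool c) ρ u v → arcL a (toList σ ++ ρ) (fsuc u) (fsuc v) ≡ arcL a' ρ u v
    arcL-suc-suc σ ρ u v = trans (arcL-++ σ ρ (fsuc u) (fsuc v))
      (cong₂ _∨_ (any-false _ (λ _ → refl) (zip (allFin c) (toList σ)))
                 (any-cong _ (arcAlong u v) (λ _ → refl) (zip (edges a') ρ)))

    arcL-zero-zero : ∀ (σ : Vec Bool c) ρ → arcL a (toList σ ++ ρ) fzero fzero ≡ false
    arcL-zero-zero σ ρ = trans (arcL-++ σ ρ fzero fzero)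
      (cong₂ _∨_ (any-false _ (λ _ → refl) (zip (allFin c) (toList σ)))
                 (any-false _ (λ _ → refl) (zip (edges a') ρ)))

    arcL-zero-suc : ∀ (σ : Vec Bool c) ρ v → arcL a (toList σ ++ ρ) fzero (fsuc v) ≡
                    any (λ p → eqᵇ (ι (proj₁ p)) v ∧ proj₂ p) (zip (allFin c) (toList σ))
    arcL-zero-suc σ ρ v = trans (arcL-++ σ ρ fzero (fsuc v))
      (trans (cong₂ _∨_ (any-cong _ _ (λ p → ∨-identityʳ _) (zip (allFin c) (toList σ)))
                        (any-false _ (λ p → ∧-zeroʳ (eqᵇ (proj₁ (proj₁ p)) v)) (zip (edges a') ρ)))
             (∨-identityʳ _))

    arcL-suc-zero : ∀ (σ : Vec Bool c) ρ v → arcL a (toList σ ++ ρ) (fsuc v) fzero ≡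
                    any (λ p → eqᵇ (ι (proj₁ p)) v ∧ not (proj₂ p)) (zip (allFin c) (toList σ))
    arcL-suc-zero σ ρ v = trans (arcL-++ σ ρ (fsuc v) fzero)
      (trans (cong₂ _∨_ (any-cong _ _ (λ p → refl) (zip (allFin c) (toList σ)))
                        (any-false _ (λ p → trans (∨-identityʳ _) (∧-zeroʳ (eqᵇ (proj₁ (proj₁ p)) v))) (zip (edges a') ρ)))
             (∨-identityʳ _))

module SinkBounds where

  open import Data.Bool.Base using (Bool; true; false; _∧_; _∨_; not)
  open import Data.Bool.Properties using (∧-zeroʳ; ∨-zeroʳ)
  open import Data.Nat.Base using (ℕ; zero; suc; _+_; s≤s; _≡ᵇ_; _<ᵇ_)
  open import Data.Fin.Base using (Fin; toℕ) renaming (zero to fzero; suc to fsuc)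
  open import Data.List.Base using (List; []; _∷_; allFin; upTo; _++_)
  open import Data.Vec.Base using (Vec; toList) renaming ([] to []ᵥ; _∷_ to _∷ᵥ_)
  open import Data.Bool.ListAction using (all)
  open import Data.List.Membership.Propositional.Properties using (∈-allFin)
  open import Data.Product.Base using (_,_)
  open import Data.Empty using ()
  open import Relation.Binary.PropositionalEquality
  open import Defs
  open BooleanLists
  open Digraphs
  open Tournaments using (trueCount)
  open Orientations

  trueCountL : List Bool → ℕ
  trueCountL [] = 0
  trueCountL (true ∷ bs) = suc (trueCountL bs)
  trueCountL (false ∷ bs) = trueCountL bs

  trueCountL-++ : ∀ xs ys → trueCountL (xs ++ ys) ≡ trueCountL xs + trueCountL ys
  trueCountL-++ [] ys = refl
  trueCountL-++ (true ∷ xs) ys = cong suc (trueCountL-++ xs ys)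
  trueCountL-++ (false ∷ xs) ys = trueCountL-++ xs ys

  trueCountL-toList : ∀ {k} (σ : Vec Bool k) → trueCountL (toList σ) ≡ trueCount σ
  trueCountL-toList []ᵥ = refl
  trueCountL-toList (true ∷ᵥ σ) = cong suc (trueCountL-toList σ)
  trueCountL-toList (false ∷ᵥ σ) = trueCountL-toList σ

  countTrue≡trueCountL : ∀ {m} (a : Fin (suc m) → ℕ) {k} (θ : Vec Bool k) → countTrue a θ ≡ trueCountL (toList θ)
  countTrue≡trueCountL a []ᵥ = refl
  countTrue≡trueCountL a (true ∷ᵥ θ) = cong suc (countTrue≡trueCountL a θ)
  countTrue≡trueCountL a (false ∷ᵥ θ) = countTrue≡trueCountL a θ

  module Γ {m : ℕ} (a : Fin (suc m) → ℕ) (bs : List Bool) = Digraph (arcL a bs)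

  acyclicᵇ : ∀ {m} (a : Fin (suc m) → ℕ) → List Bool → Bool
  acyclicᵇ a bs = not (Γ.hasCycleR a bs)

  sinksBelowᵇ : ∀ {m} (a : Fin (suc m) → ℕ) → ℕ → List Bool → Bool
  sinksBelowᵇ {m} a k bs = all (λ v → (toℕ v <ᵇ k) ∨ not (Γ.isSinkR a bs v)) (allFin (suc m))

  acyclicSinksBelow : ∀ {m} (a : Fin (suc m) → ℕ) → ℕ → List Bool → Bool
  acyclicSinksBelow a k bs = acyclicᵇ a bs ∧ sinksBelowᵇ a k bs

  sinksBelowᵇ-sound : ∀ {m} (a : Fin (suc m) → ℕ) k bs → sinksBelowᵇ a k bs ≡ true → Γ.SinksBelow a bs k
  sinksBelowᵇ-sound a k bs p v s = <ᵇ≡true⇒< _ _ (orNot (toℕ v <ᵇ k) (all≡true⁻ _ p (∈-allFin v)) s)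
    where
    orNot : ∀ x {y} → (x ∨ not y) ≡ true → y ≡ true → x ≡ true
    orNot true _ _ = refl
    orNot false () refl

  sinksBelowᵇ-complete : ∀ {m} (a : Fin (suc m) → ℕ) k bs → Γ.SinksBelow a bs k → sinksBelowᵇ a k bs ≡ true
  sinksBelowᵇ-complete {m} a k bs h = all≡true⁺ _ (allFin (suc m)) λ v _ → belowOrNotSink v
    where
    belowOrNotSink : ∀ v → ((toℕ v <ᵇ k) ∨ not (Γ.isSinkR a bs v)) ≡ true
    belowOrNotSink v with Γ.isSinkR a bs v in s
    ... | false = ∨-zeroʳ (toℕ v <ᵇ k)
    ... | true rewrite <⇒<ᵇ≡true (h v s) = refl

  acyclicSinksBelow-0 : ∀ {m} (a : Fin (suc m) → ℕ) bs → acyclicSinksBelow a 0 bs ≡ false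
  acyclicSinksBelow-0 a bs with acyclicᵇ a bs in ac
  ... | false = refl
  ... | true with sinksBelowᵇ a 0 bs in sb
  ... | false = refl
  ... | true with Γ.acyclic⇒sink a bs (Γ.noCycle⇒acyclic a bs ac) fzero
  ... | v , s with sinksBelowᵇ-sound a 0 bs sb v s
  ... | ()

  walk≡walkR : ∀ {m} (a : Fin (suc m) → ℕ) (θ : Orientation a) k u v →
               walk a θ k u v ≡ Γ.walkR a (toList θ) k u v
  walk≡walkR a θ zero u v = refl
  walk≡walkR {m} a θ (suc k) u v =
    any-cong _ _ (λ w → cong₂ _∧_ (arc≡arcL a θ u w) (walk≡walkR a θ k w v)) (allFin (suc m))

  acyclic≡acyclicᵇ : ∀ {m} (a : Fin (suc m) → ℕ) (θ : Orientation a) → acyclic a θ ≡ acyclicᵇ a (toList θ)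
  acyclic≡acyclicᵇ {m} a θ =
    cong not (any-cong _ _ (λ v → any-cong _ _ (λ k → walk≡walkR a θ (suc k) v v) (upTo (suc m))) (allFin (suc m)))

  isSink≡isSinkR : ∀ {m} (a : Fin (suc m) → ℕ) (θ : Orientation a) v → isSink a θ v ≡ Γ.isSinkR a (toList θ) v
  isSink≡isSinkR {m} a θ v = cong not (any-cong _ _ (λ w → arc≡arcL a θ v w) (allFin (suc m)))

  -- an acyclic orientation has a sink, so Sinks(θ) = {1} is equivalent to Sinks(θ) ⊆ {1}
  acyclic∧sinksIsOne≡ : ∀ {m} (a : Fin (suc m) → ℕ) (θ : Orientation a) →
                        (acyclic a θ ∧ sinksIsOne a θ) ≡ acyclicSinksBelow a 1 (toList θ)
  acyclic∧sinksIsOne≡ {m} a θ rewrite acyclic≡acyclicᵇ a θ with acyclicᵇ a (toList θ) in ac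
  ... | false = refl
  ... | true = trans (cong₂ _∧_ (isSink≡isSinkR a θ fzero) othersNotSinks)
                     (absorb (Γ.isSinkR a bs fzero) (sinksBelowᵇ a 1 bs) firstIsSink)
    where
    bs = toList θ
    isZero≡<1 : (v : Fin (suc m)) → (toℕ v ≡ᵇ 0) ≡ (toℕ v <ᵇ 1)
    isZero≡<1 fzero = refl
    isZero≡<1 (fsuc v) = refl
    othersNotSinks : all (λ v → _==_ a v fzero ∨ not (isSink a θ v)) (allFin (suc m)) ≡ sinksBelowᵇ a 1 bs
    othersNotSinks = all-cong _ _ (λ v → cong₂ _∨_ (isZero≡<1 v) (cong not (isSink≡isSinkR a θ v))) (allFin (suc m))
    firstIsSink : sinksBelowᵇ a 1 bs ≡ true → Γ.isSinkR a bs fzero ≡ true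
    firstIsSink p with Γ.acyclic⇒sink a bs (Γ.noCycle⇒acyclic a bs ac) fzero
    ... | fzero , s = s
    ... | fsuc v , s with sinksBelowᵇ-sound a 1 bs p (fsuc v) s
    ... | s≤s ()
    absorb : ∀ x y → (y ≡ true → x ≡ true) → (x ∧ y) ≡ y
    absorb x false h = ∧-zeroʳ x
    absorb x true h rewrite h refl = refl

module ConeDecomposition where

  open import Data.Bool.Base using (Bool; true; false; _∧_; not; if_then_else_)
  open import Data.Nat.Base using (ℕ; suc; _+_; _∸_; _≤_; _<_)
  open import Data.Nat.Properties using (≤-trans; ≤-pred; <-cmp; m⊓n≤m)
  open import Data.Fin.Base using (Fin; toℕ) renaming (zero to fzero; suc to fsuc)
  open import Data.Fin.Properties using (_≟_; toℕ<n; toℕ-injective)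
  open import Data.List.Base using (List; _++_; length)
  open import Data.Vec.Base using (Vec; toList; lookup)
  open import Data.Product.Base using (Σ; _×_; _,_; proj₁; proj₂)
  open import Data.Sum.Base using (inj₁; inj₂)
  open import Data.Empty using (⊥-elim)
  open import Relation.Nullary using (yes; no)
  open import Relation.Binary.PropositionalEquality
  open import Relation.Binary.Definitions using (tri<; tri≈; tri>)
  open import Defs using (isEdge; edges)
  open BooleanLists
  open Tournaments
  open Cones
  open EdgeLists
  open Orientations
  open SinkBounds

  module ConeAtFirstVertex {m : ℕ} (a : Fin (suc (suc m)) → ℕ) (reach : ∀ y → a fzero ≤ toℕ y + a y) where
    open FirstVertex a public

    ι-adjacent : ∀ i j → toℕ i < toℕ j → isEdge a' (ι i) (ι j) ≡ true
    ι-adjacent i j i<j rewrite toℕ-inject⊓ (a fzero) (suc m) i | toℕ-inject⊓ (a fzero) (suc m) j =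
      cong₂ _∧_ (<⇒<ᵇ≡true i<j) (≤⇒≤ᵇ≡true j≤i+a'i)
      where
      j≤i+a'i : toℕ j ≤ toℕ i + a' (ι i)
      j≤i+a'i = ≤-pred (≤-trans (≤-trans (toℕ<n j) (m⊓n≤m (a fzero) (suc m)))
                  (subst (λ z → a fzero ≤ suc (z + a' (ι i))) (toℕ-inject⊓ (a fzero) (suc m) i) (reach (fsuc (ι i)))))

    module Rest (ρ : List Bool) (ρ-length : length ρ ≡ length (edges a')) where
      open Γ a' ρ using () renaming (Acyclic to Acyclic'; [] to []'; _∷_ to _∷'_)

      T : Fin c → Fin c → Bool
      T i j = arcL a' ρ (ι i) (ι j)

      total : Total T
      total i j i≢j with <-cmp (toℕ i) (toℕ j)
      ... | tri< h _ _ = arcL-total a' ρ (ι i) (ι j) (ι-adjacent i j h) ρ-length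
      ... | tri≈ _ h _ = ⊥-elim (i≢j (toℕ-injective h))
      ... | tri> _ _ h with arcL-total a' ρ (ι j) (ι i) (ι-adjacent j i h) ρ-length
      ... | inj₁ x = inj₂ x
      ... | inj₂ x = inj₁ x

      module _ (ac' : Acyclic') where
        asymmetric : Asymmetric T
        asymmetric i j e with T j i in e'
        ... | false = refl
        ... | true = ⊥-elim (ac' (ι i) 1 (e ∷' (e' ∷' []')))

        transitive : Transitive T
        transitive i j k e₁ e₂ with i ≟ k
        ... | yes refl = ⊥-elim (true≢false e₂ (asymmetric i j e₁))
        ... | no i≢k with total i k i≢k
        ... | inj₁ x = x
        ... | inj₂ x = ⊥-elim (ac' (ι i) 2 (e₁ ∷' (e₂ ∷' (x ∷' []'))))

      module WithFirst (σ : Vec Bool c) where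
        R : Fin (suc (suc m)) → Fin (suc (suc m)) → Bool
        R = arcL a (toList σ ++ ρ)

        out⇒ : ∀ v → R fzero (fsuc v) ≡ true → Σ (Fin c) λ i → ι i ≡ v × lookup σ i ≡ true
        out⇒ v e with any-zipAllFin⁻ (λ i b → eqᵇ (ι i) v ∧ b) σ (trans (sym (arcL-zero-suc σ ρ v)) e)
        ... | i , q = i , eqᵇ≡true⇒≡ _ _ (proj₁ (∧≡true⇒ q)) , proj₂ (∧≡true⇒ {eqᵇ (ι i) v} q)

        out⇐ : ∀ i → lookup σ i ≡ true → R fzero (fsuc (ι i)) ≡ true
        out⇐ i σi = trans (arcL-zero-suc σ ρ (ι i)) (any-zipAllFin⁺ (λ i' b → eqᵇ (ι i') (ι i) ∧ b) σ i atI)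
          where atI : (eqᵇ (ι i) (ι i) ∧ lookup σ i) ≡ true
                atI rewrite eqᵇ-refl (ι i) = σi

        in⇒ : ∀ v → R (fsuc v) fzero ≡ true → Σ (Fin c) λ i → ι i ≡ v × lookup σ i ≡ false
        in⇒ v e with any-zipAllFin⁻ (λ i b → eqᵇ (ι i) v ∧ not b) σ (trans (sym (arcL-suc-zero σ ρ v)) e)
        ... | i , q = i , eqᵇ≡true⇒≡ _ _ (proj₁ (∧≡true⇒ q)) , not≡true⇒ (proj₂ (∧≡true⇒ {eqᵇ (ι i) v} q))

        in⇐ : ∀ i → lookup σ i ≡ false → R (fsuc (ι i)) fzero ≡ true
        in⇐ i σi = trans (arcL-suc-zero σ ρ (ι i)) (any-zipAllFin⁺ (λ i' b → eqᵇ (ι i') (ι i) ∧ not b) σ i atI)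
          where atI : (eqᵇ (ι i) (ι i) ∧ not (lookup σ i)) ≡ true
                atI rewrite eqᵇ-refl (ι i) | σi = refl

        open Cone R (arcL a' ρ) ι σ (arcL-suc-suc σ ρ) (arcL-zero-zero σ ρ) out⇒ out⇐ in⇒ in⇐

        acyclicᵇ-cyclic : acyclicᵇ a' ρ ≡ false → acyclicᵇ a (toList σ ++ ρ) ≡ false
        acyclicᵇ-cyclic e with acyclicᵇ a (toList σ ++ ρ) in e'
        ... | false = refl
        ... | true = ⊥-elim (true≢false
                       (Γ.acyclic⇒noCycle a' ρ (acyclic⇒acyclic' (Γ.noCycle⇒acyclic a (toList σ ++ ρ) e'))) e)

        module _ (ac'ᵇ : acyclicᵇ a' ρ ≡ true) where
          ac' : Acyclic'
          ac' = Γ.noCycle⇒acyclic a' ρ ac'ᵇ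

          acyclicᵇ-acyclic : acyclicᵇ a (toList σ ++ ρ) ≡ UpClosure.isUpClosed T σ
          acyclicᵇ-acyclic = ≡-fromImplications
            (λ p → UpClosure.isUpClosed-complete T σ (acyclicᵇ⇒upClosed p))
            (λ p → Γ.acyclic⇒noCycle a _ (coneAcyclic total ac' (UpClosure.isUpClosed-sound T σ p)))
            where acyclicᵇ⇒upClosed = λ p → acyclic⇒upClosed (Γ.noCycle⇒acyclic a (toList σ ++ ρ) p)

          sinksBelowᵇ-++ : ∀ k → 1 ≤ k → k ≤ suc c → UpClosure.isUpClosed T σ ≡ true →
            sinksBelowᵇ a k (toList σ ++ ρ) ≡ (if allFalse σ then sinksBelowᵇ a' c ρ else sinksBelowᵇ a' (k ∸ 1) ρ)
          sinksBelowᵇ-++ k 1≤k k≤1+c upClosed with allFalse σ in allIn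
          ... | true = ≡-fromImplications
                  (λ p → sinksBelowᵇ-complete a' c ρ (Z.sinksBelow⇒ (sinksBelowᵇ-sound a k _ p)))
                  (λ p → sinksBelowᵇ-complete a k _ (Z.sinksBelow⇐ (sinksBelowᵇ-sound a' c ρ p)))
            where module Z = ZeroIsSink (allFalse⇒ σ allIn) (toℕ-inject⊓ (a fzero) (suc m))
                                        (inject⊓-onto (a fzero) (suc m)) k 1≤k k≤1+c
          ... | false with ¬allFalse⇒ σ allIn
          ... | i₀ , σi₀ = ≡-fromImplications
                  (λ p → sinksBelowᵇ-complete a' (k ∸ 1) ρ (O.sinksBelow⇒ (sinksBelowᵇ-sound a k _ p)))
                  (λ p → sinksBelowᵇ-complete a k _ (O.sinksBelow⇐ (sinksBelowᵇ-sound a' (k ∸ 1) ρ p)))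
            where module O = ZeroHasOutArc total (UpClosure.isUpClosed-sound T σ upClosed) i₀ σi₀ k 1≤k

module Recurrence where

  open import Level using (Level)
  open import Data.Bool.Base using (Bool; true; false; _∧_; if_then_else_)
  open import Data.Nat.Base using (ℕ; suc; _∸_; _≤_; _⊓_) renaming (_+_ to _+ℕ_)
  open import Data.Fin.Base using (Fin; toℕ) renaming (zero to fzero)
  open import Data.List.Base using (List; _++_; length)
  open import Data.Vec.Base using (Vec; toList)
  open import Data.Vec.Properties using (length-toList)
  open import Function.Base using (_∘_)
  open import Algebra.Bundles using (CommutativeSemiring)
  import Relation.Binary.PropositionalEquality as ≡
  open ≡ using (_≡_)
  open import Defs using (edges; module Poly)
  open Tournaments using (allFalse; trueCount; allFalse⇒trueCount≡0; module UpClosure)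
  open SemiringSums
  open SinkBounds
  open EdgeLists using (length-edges)
  open ConeDecomposition

  module SinkBoundedGF {s ℓ : Level} (S : CommutativeSemiring s ℓ) (q : CommutativeSemiring.Carrier S) where
    open CommutativeSemiring S
    open Poly S
    open Sums S q
    open import Relation.Binary.Reasoning.Setoid setoid

    weight : ∀ {m} (a : Fin (suc m) → ℕ) → ℕ → List Bool → Carrier
    weight a k bs = if acyclicSinksBelow a k bs then pow q (trueCountL bs) else 0#

    sinkBoundedGF : ∀ {m} (a : Fin (suc m) → ℕ) → ℕ → Carrier
    sinkBoundedGF a k = sumVec (length (edges a)) (weight a k ∘ toList)

    sinkBoundedGF-0 : ∀ {m} (a : Fin (suc m) → ℕ) → sinkBoundedGF a 0 ≈ 0#
    sinkBoundedGF-0 a = trans (sumVec-cong (length (edges a)) _ _ noWeight) (sumVec-0# (length (edges a)))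
      where
      noWeight : ∀ θ → weight a 0 (toList θ) ≈ 0#
      noWeight θ = reflexive (≡.cong (λ b → if b then pow q (trueCountL (toList θ)) else 0#)
                                     (acyclicSinksBelow-0 a (toList θ)))

    weight-acyclicᵇ : ∀ {m} (a : Fin (suc m) → ℕ) j bs {x} → acyclicᵇ a bs ≡ x →
                      weight a j bs ≡ (if x ∧ sinksBelowᵇ a j bs then pow q (trueCountL bs) else 0#)
    weight-acyclicᵇ a j bs e = ≡.cong (λ b → if b ∧ sinksBelowᵇ a j bs then pow q (trueCountL bs) else 0#) e

    if-pow-+ : ∀ b n₁ n₂ → (if b then pow q (n₁ +ℕ n₂) else 0#) ≈ pow q n₁ * (if b then pow q n₂ else 0#)
    if-pow-+ false n₁ n₂ = sym (zeroʳ _)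
    if-pow-+ true n₁ n₂ = pow-+ n₁ n₂

    module Step {m : ℕ} (a : Fin (suc (suc m)) → ℕ) (reach : ∀ y → a fzero ≤ toℕ y +ℕ a y)
                (k : ℕ) (1≤k : 1 ≤ k) (k≤1+c : k ≤ suc (a fzero ⊓ suc m)) where
      open ConeAtFirstVertex a reach

      reducedWeight : List Bool → Carrier
      reducedWeight ρ = weight a' c ρ + (q * qint q c) * weight a' (k ∸ 1) ρ

      sumFirst-cyclic : ∀ ρ → length ρ ≡ length (edges a') → acyclicᵇ a' ρ ≡ false →
                        sumVec c (λ σ → weight a k (toList σ ++ ρ)) ≈ reducedWeight ρ
      sumFirst-cyclic ρ ρ-length cyclic = begin
        sumVec c (λ σ → weight a k (toList σ ++ ρ)) ≈⟨ sumVec-cong c _ _ (λ σ → reflexive (noWeight σ)) ⟩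
        sumVec c (λ _ → 0#) ≈⟨ sumVec-0# c ⟩
        0# ≈⟨ sym (+-identityʳ 0#) ⟩
        0# + 0# ≈⟨ +-congˡ (sym (zeroʳ _)) ⟩
        0# + (q * qint q c) * 0#
          ≈⟨ sym (+-cong (reflexive (weight-acyclicᵇ a' c ρ cyclic))
                         (*-congˡ (reflexive (weight-acyclicᵇ a' (k ∸ 1) ρ cyclic)))) ⟩
        reducedWeight ρ ∎
        where
        noWeight : ∀ σ → weight a k (toList σ ++ ρ) ≡ 0#
        noWeight σ rewrite Rest.WithFirst.acyclicᵇ-cyclic ρ ρ-length σ cyclic = ≡.refl

      sumFirst-acyclic : ∀ ρ → (ρ-length : length ρ ≡ length (edges a')) → acyclicᵇ a' ρ ≡ true →
                         sumVec c (λ σ → weight a k (toList σ ++ ρ)) ≈ reducedWeight ρ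
      sumFirst-acyclic ρ ρ-length ac'ᵇ = begin
        sumVec c (λ σ → weight a k (toList σ ++ ρ)) ≈⟨ sumVec-cong c _ _ termwise ⟩
        sumVec c (λ σ → if isUpClosed σ then (if allFalse σ then X else pow q (trueCount σ) * Y) else 0#)
          ≈⟨ upClosedSum c T total (asymmetric ac') (transitive ac') X Y ⟩
        X + (q * qint q c) * Y ∎
        where
        open Rest ρ ρ-length
        open UpClosure T using (isUpClosed)
        ac' = Γ.noCycle⇒acyclic a' ρ ac'ᵇ
        X = weight a' c ρ
        Y = weight a' (k ∸ 1) ρ
        termwise : ∀ σ → weight a k (toList σ ++ ρ) ≈
                         (if isUpClosed σ then (if allFalse σ then X else pow q (trueCount σ) * Y) else 0#)
        termwise σ rewrite WithFirst.acyclicᵇ-acyclic σ ac'ᵇ | trueCountL-++ (toList σ) ρ | trueCountL-toList σ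
          with isUpClosed σ in upClosed
        ... | false = refl
        ... | true rewrite WithFirst.sinksBelowᵇ-++ σ ac'ᵇ k 1≤k k≤1+c upClosed with allFalse σ in allIn
        ... | true = trans (reflexive (≡.cong (λ n → if sinksBelowᵇ a' c ρ then pow q (n +ℕ trueCountL ρ) else 0#)
                                             (allFalse⇒trueCount≡0 σ allIn)))
                           (reflexive (≡.sym (weight-acyclicᵇ a' c ρ ac'ᵇ)))
        ... | false = trans (if-pow-+ (sinksBelowᵇ a' (k ∸ 1) ρ) (trueCount σ) (trueCountL ρ))
                            (*-congˡ (reflexive (≡.sym (weight-acyclicᵇ a' (k ∸ 1) ρ ac'ᵇ))))

      sumFirst : ∀ (ρ : Vec Bool (length (edges a'))) →
                 sumVec c (λ σ → weight a k (toList σ ++ toList ρ)) ≈ reducedWeight (toList ρ)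
      sumFirst ρ = byAcyclicity (acyclicᵇ a' (toList ρ)) ≡.refl
        where
        byAcyclicity : ∀ b → acyclicᵇ a' (toList ρ) ≡ b →
                       sumVec c (λ σ → weight a k (toList σ ++ toList ρ)) ≈ reducedWeight (toList ρ)
        byAcyclicity false = sumFirst-cyclic (toList ρ) (length-toList ρ)
        byAcyclicity true = sumFirst-acyclic (toList ρ) (length-toList ρ)

      sinkBoundedGF-step : sinkBoundedGF a k ≈ sinkBoundedGF a' c + (q * qint q c) * sinkBoundedGF a' (k ∸ 1)
      sinkBoundedGF-step = begin
        sinkBoundedGF a k ≡⟨ ≡.cong (λ n → sumVec n (weight a k ∘ toList)) (length-edges a) ⟩
        sumVec (c +ℕ N) (weight a k ∘ toList) ≈⟨ sumVec-++ c N (weight a k) ⟩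
        sumVec c (λ σ → sumVec N (λ ρ → weight a k (toList σ ++ toList ρ)))
          ≈⟨ sumVec-swap c N (λ σ ρ → weight a k (toList σ ++ toList ρ)) ⟩
        sumVec N (λ ρ → sumVec c (λ σ → weight a k (toList σ ++ toList ρ))) ≈⟨ sumVec-cong N _ _ sumFirst ⟩
        sumVec N (λ ρ → reducedWeight (toList ρ)) ≈⟨ sumVec-+ N _ _ ⟩
        sinkBoundedGF a' c + sumVec N (λ ρ → (q * qint q c) * weight a' (k ∸ 1) (toList ρ))
          ≈⟨ +-congˡ (sumVec-*ˡ N (q * qint q c) (λ ρ → weight a' (k ∸ 1) (toList ρ))) ⟩
        sinkBoundedGF a' c + (q * qint q c) * sinkBoundedGF a' (k ∸ 1) ∎
        where
        N = length (edges a')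

module ProductFormula where

  open import Level using (Level)
  open import Data.Bool.Base using (_∧_; if_then_else_)
  open import Data.Nat.Base using (ℕ; zero; suc; _≤_; z≤n; s≤s; _⊓_) renaming (_+_ to _+ℕ_)
  import Data.Nat.Properties as ℕ
  open import Data.Fin.Base using (Fin; toℕ; inject₁) renaming (zero to fzero; suc to fsuc)
  open import Data.Fin.Properties using (toℕ-inject₁)
  open import Data.List.Base using (_∷_; map; allFin; length)
  open import Data.List.Properties using (map-∘)
  open import Data.Vec.Base using (toList)
  open import Function.Base using (_∘_)
  open import Algebra.Bundles using (CommutativeSemiring)
  import Algebra.Properties.CommutativeSemigroup as CommSemigroupProperties
  import Relation.Binary.PropositionalEquality as ≡
  open ≡ using (_≡_)
  open import Defs using (allVecs; edges; acyclic; sinksIsOne; asc; module Poly)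
  open BooleanLists using (allFin-suc)
  open SemiringSums
  open SinkBounds using (acyclic∧sinksIsOne≡; countTrue≡trueCountL)
  open Recurrence

  SlowlyDecreasing : ∀ {m} → (Fin (suc m) → ℕ) → Set
  SlowlyDecreasing {m} a = ∀ (i : Fin m) → a (inject₁ i) ≤ suc (a (fsuc i))

  SlowlyDecreasing-tail : ∀ {m} (a : Fin (suc (suc m)) → ℕ) → SlowlyDecreasing a → SlowlyDecreasing (a ∘ fsuc)
  SlowlyDecreasing-tail a dec i = dec (fsuc i)

  -- i + a_i is nondecreasing in i; hence the neighbours of the first vertex form a clique
  reach-first≤reach : ∀ {m} (a : Fin (suc m) → ℕ) → SlowlyDecreasing a → ∀ y → a fzero ≤ toℕ y +ℕ a y
  reach-first≤reach {m} a dec y = go (toℕ y) y ≡.refl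
    where
    go : ∀ n (y : Fin (suc m)) → toℕ y ≡ n → a fzero ≤ toℕ y +ℕ a y
    go zero fzero _ = ℕ.≤-refl
    go (suc n) (fsuc y) e = ℕ.≤-trans (go n (inject₁ y) (≡.trans (toℕ-inject₁ y) (ℕ.suc-injective e)))
                              (ℕ.≤-trans (ℕ.+-monoʳ-≤ (toℕ (inject₁ y)) (dec y)) (ℕ.≤-reflexive shift))
      where
      shift : toℕ (inject₁ y) +ℕ suc (a (fsuc y)) ≡ suc (toℕ y) +ℕ a (fsuc y)
      shift = ≡.trans (ℕ.+-suc (toℕ (inject₁ y)) _) (≡.cong (λ z → suc (z +ℕ a (fsuc y))) (toℕ-inject₁ y))

  module Formula {s ℓ : Level} (S : CommutativeSemiring s ℓ) (q : CommutativeSemiring.Carrier S) where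
    open CommutativeSemiring S
    open Poly S
    open Sums S q
    open SinkBoundedGF S q
    open import Relation.Binary.Reasoning.Setoid setoid
    open CommSemigroupProperties *-commutativeSemigroup using () renaming (interchange to *-interchange)

    prodTrunc : ∀ {m} → (Fin (suc m) → ℕ) → Carrier
    prodTrunc {zero} a = 1#
    prodTrunc {suc m} a = qint q (a fzero ⊓ suc m) * prodTrunc (a ∘ fsuc)

    sinkBoundedGF≈qint*prodTrunc : ∀ m (a : Fin (suc m) → ℕ) → SlowlyDecreasing a → ∀ k → 1 ≤ k → k ≤ suc (a fzero ⊓ m) →
                     sinkBoundedGF a k ≈ qint q k * prodTrunc a
    sinkBoundedGF≈qint*prodTrunc zero a dec k 1≤k k≤ with ℕ.≤-antisym (≡.subst (λ z → k ≤ suc z) (ℕ.⊓-zeroʳ (a fzero)) k≤) 1≤k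
    ... | ≡.refl = sym (*-identityʳ _)
    sinkBoundedGF≈qint*prodTrunc (suc m) a dec (suc k) (s≤s z≤n) k≤ = begin
      sinkBoundedGF a (suc k) ≈⟨ Step.sinkBoundedGF-step a (reach-first≤reach a dec) (suc k) (s≤s z≤n) k≤ ⟩
      sinkBoundedGF a' c + (q * qint q c) * sinkBoundedGF a' k ≈⟨ +-cong (tail c c≤) (*-congˡ (tail k k≤')) ⟩
      qint q c * prodTrunc a' + (q * qint q c) * (qint q k * prodTrunc a')
        ≈⟨ +-congˡ (*-interchange q (qint q c) (qint q k) (prodTrunc a')) ⟩
      qint q c * prodTrunc a' + (q * qint q k) * (qint q c * prodTrunc a') ≈⟨ +-congʳ (sym (*-identityˡ _)) ⟩
      1# * (qint q c * prodTrunc a') + (q * qint q k) * (qint q c * prodTrunc a') ≈⟨ sym (distribʳ _ _ _) ⟩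
      (1# + q * qint q k) * (qint q c * prodTrunc a') ≈⟨ *-congʳ (sym (qint-suc k)) ⟩
      qint q (suc k) * prodTrunc a ∎
      where
      c = a fzero ⊓ suc m
      a' = a ∘ fsuc
      tail : ∀ j → j ≤ suc (a' fzero ⊓ m) → sinkBoundedGF a' j ≈ qint q j * prodTrunc a'
      tail zero _ = trans (sinkBoundedGF-0 a') (sym (zeroˡ _))
      tail (suc j) h = sinkBoundedGF≈qint*prodTrunc m a' (SlowlyDecreasing-tail a dec) (suc j) (s≤s z≤n) h
      c≤ : c ≤ suc (a' fzero ⊓ m)
      c≤ = ℕ.⊓-monoˡ-≤ (suc m) (dec fzero)
      k≤' : k ≤ suc (a' fzero ⊓ m)
      k≤' = ℕ.≤-trans (ℕ.≤-pred k≤) c≤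

    sinkOneGF≈sinkBoundedGF : ∀ {m} (a : Fin (suc m) → ℕ) → sinkOneGF a q ≈ sinkBoundedGF a 1
    sinkOneGF≈sinkBoundedGF a = sumL-map-cong _ _ termwise (allVecs (length (edges a)))
      where
      termwise : ∀ θ → (if acyclic a θ ∧ sinksIsOne a θ then pow q (asc a θ) else 0#) ≈ weight a 1 (toList θ)
      termwise θ rewrite acyclic∧sinksIsOne≡ a θ | countTrue≡trueCountL a θ = refl

    prodTrunc≈prodA : ∀ m (a : Fin (suc m) → ℕ) → (∀ i → toℕ i +ℕ a i ≤ m) → prodTrunc a ≈ prodA a q
    prodTrunc≈prodA zero a bounded = refl
    prodTrunc≈prodA (suc m) a bounded = begin
      qint q (a fzero ⊓ suc m) * prodTrunc (a ∘ fsuc)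
        ≡⟨ ≡.cong (λ z → qint q z * prodTrunc (a ∘ fsuc)) (ℕ.m≤n⇒m⊓n≡m (bounded fzero)) ⟩
      qint q (a fzero) * prodTrunc (a ∘ fsuc)
        ≈⟨ *-congˡ (prodTrunc≈prodA m (a ∘ fsuc) (λ i → ℕ.≤-pred (bounded (fsuc i)))) ⟩
      qint q (a fzero) * prodA (a ∘ fsuc) q
        ≡⟨ ≡.cong prodL (≡.sym (≡.trans (≡.cong (map f) (allFin-suc m)) (≡.cong (f fzero ∷_) (≡.sym (map-∘ (allFin m)))))) ⟩
      prodA a q ∎
      where f = λ (i : Fin (suc m)) → qint q (a (inject₁ i))

module BackDegrees where

  open import Level using (Level)
  open import Data.Bool.Base using (true; false; _∧_; if_then_else_)
  open import Data.Nat.Base using (ℕ; zero; suc; _∸_; _≤_; _<_; s≤s; _⊓_; _<ᵇ_; _≤ᵇ_) renaming (_+_ to _+ℕ_)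
  import Data.Nat.Properties as ℕ
  open import Data.Fin.Base using (Fin; toℕ) renaming (zero to fzero; suc to fsuc)
  open import Data.List.Base using (List; _∷_; map; allFin; length; filterᵇ)
  open import Data.List.Properties using (length-map; length-tabulate)
  open import Data.Empty using (⊥-elim)
  open import Function.Base using (_∘_)
  open import Algebra.Bundles using (CommutativeSemiring)
  import Relation.Binary.PropositionalEquality as ≡
  open ≡ using (_≡_)
  open import Defs using (module Poly)
  open BooleanLists
  open EdgeLists using (inject⊓; filterᵇ-toℕ<ᵇ)
  open SemiringSums
  open ProductFormula

  -- b_{n+1} (vertices are counted from 0): the number of neighbours i < n of vertex n in Γ_a
  backDegree : ∀ {m} (a : Fin (suc m) → ℕ) → ℕ → ℕ
  backDegree {m} a n = length (filterᵇ (λ i → (toℕ i <ᵇ n) ∧ (n ≤ᵇ toℕ i +ℕ a i)) (allFin (suc m)))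

  below : ℕ → ℕ → ℕ
  below d n = if n <ᵇ d then 1 else 0

  backDegree-suc : ∀ {m} (a : Fin (suc (suc m)) → ℕ) n → backDegree a (suc n) ≡ below (a fzero) n +ℕ backDegree (a ∘ fsuc) n
  backDegree-suc {m} a n = begin
    length (filterᵇ p (allFin (suc (suc m)))) ≡⟨ ≡.cong (length ∘ filterᵇ p) (allFin-suc (suc m)) ⟩
    length (filterᵇ p (fzero ∷ map fsuc (allFin (suc m)))) ≡⟨ ≡.cong length (filterᵇ-∷ p fzero _) ⟩
    length (if n <ᵇ a fzero then fzero ∷ filterᵇ p (map fsuc (allFin (suc m))) else filterᵇ p (map fsuc (allFin (suc m))))
      ≡⟨ length-if (n <ᵇ a fzero) _ ⟩
    below (a fzero) n +ℕ length (filterᵇ p (map fsuc (allFin (suc m))))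
      ≡⟨ ≡.cong (λ z → below (a fzero) n +ℕ length z) (filterᵇ-map p fsuc (allFin (suc m))) ⟩
    below (a fzero) n +ℕ length (map fsuc (filterᵇ (p ∘ fsuc) (allFin (suc m))))
      ≡⟨ ≡.cong (below (a fzero) n +ℕ_) (length-map fsuc (filterᵇ (p ∘ fsuc) (allFin (suc m)))) ⟩
    below (a fzero) n +ℕ length (filterᵇ (p ∘ fsuc) (allFin (suc m)))
      ≡⟨ ≡.cong (λ z → below (a fzero) n +ℕ length z) (filterᵇ-cong _ _ p-suc (allFin (suc m))) ⟩
    below (a fzero) n +ℕ backDegree (a ∘ fsuc) n ∎
    where
    open ≡.≡-Reasoning
    p = λ (i : Fin (suc (suc m))) → (toℕ i <ᵇ suc n) ∧ (suc n ≤ᵇ toℕ i +ℕ a i)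
    p-suc : ∀ i → p (fsuc i) ≡ ((toℕ i <ᵇ n) ∧ (n ≤ᵇ toℕ i +ℕ a (fsuc i)))
    p-suc i = ≡.cong ((toℕ i <ᵇ n) ∧_) (<ᵇ-suc n (toℕ i +ℕ a (fsuc i)))
    length-if : ∀ b (xs : List (Fin (suc (suc m)))) → length (if b then fzero ∷ xs else xs) ≡ (if b then 1 else 0) +ℕ length xs
    length-if true xs = ≡.refl
    length-if false xs = ≡.refl

  backDegree-0 : ∀ {m} (a : Fin (suc m) → ℕ) → backDegree a 0 ≡ 0
  backDegree-0 {m} a = ≡.cong length (filterᵇ-none _ (λ _ → ≡.refl) (allFin (suc m)))

  backDegree-neighbourOfFirst : ∀ {m} (a : Fin (suc (suc m)) → ℕ) → SlowlyDecreasing a →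
                                ∀ n → n < a fzero ⊓ suc m → backDegree (a ∘ fsuc) n ≡ n
  backDegree-neighbourOfFirst {m} a dec n n<c = begin
    backDegree (a ∘ fsuc) n ≡⟨ ≡.cong length (filterᵇ-cong _ _ reaches (allFin (suc m))) ⟩
    length (filterᵇ (λ j → toℕ j <ᵇ n) (allFin (suc m))) ≡⟨ ≡.cong length (filterᵇ-toℕ<ᵇ n (suc m)) ⟩
    length (map (inject⊓ n (suc m)) (allFin (n ⊓ suc m))) ≡⟨ length-map _ (allFin (n ⊓ suc m)) ⟩
    length (allFin (n ⊓ suc m)) ≡⟨ length-tabulate (λ x → x) ⟩
    n ⊓ suc m ≡⟨ ℕ.m≤n⇒m⊓n≡m (ℕ.<⇒≤ (ℕ.<-≤-trans n<c (ℕ.m⊓n≤n (a fzero) (suc m)))) ⟩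
    n ∎
    where
    open ≡.≡-Reasoning
    reaches : ∀ i → ((toℕ i <ᵇ n) ∧ (n ≤ᵇ toℕ i +ℕ a (fsuc i))) ≡ (toℕ i <ᵇ n)
    reaches i with toℕ i <ᵇ n
    ... | false = ≡.refl
    ... | true = ≤⇒≤ᵇ≡true (ℕ.≤-pred (ℕ.≤-trans (ℕ.≤-trans n<c (ℕ.m⊓n≤m (a fzero) (suc m)))
                                               (reach-first≤reach a dec (fsuc i))))

  module BackFormula {s ℓ : Level} (S : CommutativeSemiring s ℓ) (q : CommutativeSemiring.Carrier S) where
    open CommutativeSemiring S
    open Poly S
    open Sums S q
    open Formula S q using (prodTrunc)
    open import Relation.Binary.Reasoning.Setoid setoid

    ProdBackDegreesStep : ∀ {m} → (Fin (suc (suc m)) → ℕ) → Set ℓ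
    ProdBackDegreesStep {m} a =
      prodUpTo (λ n → qint q (below (a fzero) n +ℕ backDegree (a ∘ fsuc) n)) (suc m)
        ≈ qint q (a fzero ⊓ suc m) * prodUpTo (λ n → qint q (backDegree (a ∘ fsuc) (suc n))) m

    prodBackDegrees-step-isolated : ∀ {m} (a : Fin (suc (suc m)) → ℕ) → a fzero ≡ 0 → ProdBackDegreesStep a
    prodBackDegrees-step-isolated {m} a a₀≡0 = begin
      prodUpTo H (suc m) ≡⟨ prodUpTo-suc H m ⟩
      qint q (below (a fzero) 0 +ℕ backDegree (a ∘ fsuc) 0) * prodUpTo (H ∘ suc) m
        ≡⟨ ≡.cong₂ (λ d e → qint q (below d 0 +ℕ e) * prodUpTo (H ∘ suc) m) a₀≡0 (backDegree-0 (a ∘ fsuc)) ⟩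
      0# * prodUpTo (H ∘ suc) m ≈⟨ zeroˡ _ ⟩
      0# ≈⟨ sym (zeroˡ _) ⟩
      0# * prodUpTo (λ n → qint q (backDegree (a ∘ fsuc) (suc n))) m
        ≡⟨ ≡.cong (λ d → qint q (d ⊓ suc m) * prodUpTo (λ n → qint q (backDegree (a ∘ fsuc) (suc n))) m) (≡.sym a₀≡0) ⟩
      qint q (a fzero ⊓ suc m) * prodUpTo (λ n → qint q (backDegree (a ∘ fsuc) (suc n))) m ∎
      where H = λ n → qint q (below (a fzero) n +ℕ backDegree (a ∘ fsuc) n)

    -- The vertices 2, …, c + 1 adjacent to the first vertex have back-degrees 1, …, c, so
    -- the first c factors on the left form [c]_q!, and those on the right [c - 1]_q!.
    prodBackDegrees-step-adjacent : ∀ {m} (a : Fin (suc (suc m)) → ℕ) → SlowlyDecreasing a →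
                                    ∀ d → a fzero ≡ suc d → ProdBackDegreesStep a
    prodBackDegrees-step-adjacent {m} a dec d a₀≡ = begin
      prodUpTo H (suc m) ≡⟨ ≡.cong (prodUpTo H) (≡.cong suc m≡c'+r) ⟩
      prodUpTo H (c +ℕ r) ≈⟨ prodUpTo-+ c r H ⟩
      prodUpTo H c * prodUpTo (λ n → H (c +ℕ n)) r ≈⟨ *-cong (prodUpTo-cong c H _ H-prefix) (prodUpTo-cong r _ _ H-rest) ⟩
      qFactorial c * Z ≈⟨ *-congʳ (qFactorial-suc c') ⟩
      (qFactorial c' * qint q c) * Z ≈⟨ *-congʳ (*-comm _ _) ⟩
      (qint q c * qFactorial c') * Z ≈⟨ *-assoc _ _ _ ⟩
      qint q c * (qFactorial c' * Z) ≈⟨ *-congˡ (*-congʳ (sym (prodUpTo-cong c' G _ G-prefix))) ⟩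
      qint q c * (prodUpTo G c' * prodUpTo (λ n → G (c' +ℕ n)) r) ≈⟨ *-congˡ (sym (prodUpTo-+ c' r G)) ⟩
      qint q c * prodUpTo G (c' +ℕ r) ≡⟨ ≡.cong₂ (λ x y → qint q x * prodUpTo G y) (≡.sym c≡) (≡.sym m≡c'+r) ⟩
      qint q (a fzero ⊓ suc m) * prodUpTo G m ∎
      where
      f = backDegree (a ∘ fsuc)
      H = λ n → qint q (below (a fzero) n +ℕ f n)
      G = λ n → qint q (f (suc n))
      c' = d ⊓ m
      c = suc c'
      r = m ∸ c'
      m≡c'+r : m ≡ c' +ℕ r
      m≡c'+r = ≡.sym (ℕ.m+[n∸m]≡n (ℕ.m⊓n≤n d m))
      Z = prodUpTo (λ n → qint q (f (c +ℕ n))) r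
      c≡ : a fzero ⊓ suc m ≡ c
      c≡ = ≡.cong (_⊓ suc m) a₀≡
      H-prefix : ∀ n → n < c → H n ≈ qint q (suc n)
      H-prefix n n<c rewrite a₀≡ | <⇒<ᵇ≡true (ℕ.<-≤-trans n<c (ℕ.m⊓n≤m (suc d) (suc m))) =
        reflexive (≡.cong (qint q ∘ suc) (backDegree-neighbourOfFirst a dec n (≡.subst (n <_) (≡.sym c≡) n<c)))
      G-prefix : ∀ n → n < c' → G n ≈ qint q (suc n)
      G-prefix n n<c' = reflexive (≡.cong (qint q)
        (backDegree-neighbourOfFirst a dec (suc n) (≡.subst (suc n <_) (≡.sym c≡) (s≤s n<c'))))
      H-rest : ∀ n → n < r → H (c +ℕ n) ≈ qint q (f (c +ℕ n))
      H-rest n n<r rewrite a₀≡ with (c +ℕ n) <ᵇ suc d in e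
      ... | false = refl
      ... | true = ⊥-elim (ℕ.<-irrefl ≡.refl (ℕ.<-≤-trans c+n<c (ℕ.m≤m+n c n)))
        where
        c+n<1+m : c +ℕ n < suc m
        c+n<1+m = s≤s (≡.subst (suc (c' +ℕ n) ≤_) (≡.sym m≡c'+r) (ℕ.+-monoʳ-< c' n<r))
        c+n<c : c +ℕ n < c
        c+n<c = ℕ.⊓-glb (<ᵇ≡true⇒< _ _ e) c+n<1+m

    prodB≈prodTrunc : ∀ m (a : Fin (suc m) → ℕ) → SlowlyDecreasing a → prodB a q ≈ prodTrunc a
    prodB≈prodTrunc zero a dec = refl
    prodB≈prodTrunc (suc m) a dec = begin
      prodUpTo (λ n → qint q (backDegree a (suc n))) (suc m)
        ≈⟨ prodUpTo-cong (suc m) _ _ (λ n _ → reflexive (≡.cong (qint q) (backDegree-suc a n))) ⟩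
      prodUpTo (λ n → qint q (below (a fzero) n +ℕ backDegree (a ∘ fsuc) n)) (suc m) ≈⟨ byFirst (a fzero) ≡.refl ⟩
      qint q (a fzero ⊓ suc m) * prodB (a ∘ fsuc) q ≈⟨ *-congˡ (prodB≈prodTrunc m (a ∘ fsuc) (SlowlyDecreasing-tail a dec)) ⟩
      prodTrunc a ∎
      where
      byFirst : ∀ d → a fzero ≡ d → ProdBackDegreesStep a
      byFirst zero = prodBackDegrees-step-isolated a
      byFirst (suc d) = prodBackDegrees-step-adjacent a dec d


open import Data.Nat.Base using (zero; _∸_; _≤_; _<_; z≤n; s≤s; _%_) renaming (_+_ to _+ℕ_)
import Data.Nat.Properties as ℕ
open import Data.Nat.DivMod using (m<n⇒m%n≡m)
open import Data.Fin.Base using (toℕ; inject₁; fromℕ<) renaming (suc to fsuc)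
open import Data.Fin.Properties using (toℕ-inject₁; toℕ<n; toℕ≤pred[n]; toℕ-injective; toℕ-fromℕ<)
open import Data.Product.Base using (_,_)
import Relation.Binary.PropositionalEquality as ≡
open Recurrence using (module SinkBoundedGF)
open ProductFormula
open BackDegrees using (module BackFormula)

IsAreaSeq⇒SlowlyDecreasing : ∀ {m} (a : Fin (suc m) → ℕ) → IsAreaSeq a → SlowlyDecreasing a
IsAreaSeq⇒SlowlyDecreasing {m} a area i = IsAreaSeq.step area (inject₁ i) (fsuc i)
  (≡.sym (≡.trans (≡.cong (λ z → suc z % suc m) (toℕ-inject₁ i)) (m<n⇒m%n≡m (s≤s (toℕ<n i)))))

-- a_n = 0 and a_i ≤ a_{i+1} + 1 give a_i ≤ n - i
IsAreaSeq⇒reach≤m : ∀ {m} (a : Fin (suc m) → ℕ) → IsAreaSeq a → ∀ i → toℕ i +ℕ a i ≤ m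
IsAreaSeq⇒reach≤m {m} a area i =
  ℕ.≤-trans (ℕ.+-monoʳ-≤ (toℕ i) (a≤ (m ∸ toℕ i) i (ℕ.m+[n∸m]≡n (toℕ≤pred[n] i))))
            (ℕ.≤-reflexive (ℕ.m+[n∸m]≡n (toℕ≤pred[n] i)))
  where
  a≤ : ∀ d (i : Fin (suc m)) → toℕ i +ℕ d ≡.≡ m → a i ≤ d
  a≤ zero i e = ℕ.≤-reflexive (IsAreaSeq.last0 area i (≡.trans (≡.sym (ℕ.+-identityʳ _)) e))
  a≤ (suc d) i e = ≡.subst (λ z → a z ≤ suc d) inject₁j≡i
                    (ℕ.≤-trans (IsAreaSeq⇒SlowlyDecreasing a area j) (s≤s (a≤ d (fsuc j) next)))
    where
    i<m : toℕ i < m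
    i<m = ≡.subst (toℕ i <_) e (ℕ.m<m+n (toℕ i) (s≤s z≤n))
    j = fromℕ< i<m
    inject₁j≡i : inject₁ j ≡.≡ i
    inject₁j≡i = toℕ-injective (≡.trans (toℕ-inject₁ j) (toℕ-fromℕ< i<m))
    next : toℕ (fsuc j) +ℕ d ≡.≡ m
    next = ≡.trans (≡.cong (λ z → suc z +ℕ d) (toℕ-fromℕ< i<m)) (≡.trans (≡.sym (ℕ.+-suc (toℕ i) d)) e)

mainTheorem20 : ∀ {c ℓ} (R : CommutativeSemiring c ℓ) (m : ℕ) (a : Fin (suc m) → ℕ)
    → IsAreaSeq a → Connected a → (q : CommutativeSemiring.Carrier R)
    → (CommutativeSemiring._≈_ R (Poly.sinkOneGF R a q) (Poly.prodA R a q))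
      × (CommutativeSemiring._≈_ R (Poly.prodA R a q) (Poly.prodB R a q))
mainTheorem20 R m a area _ q = sinkOneGF≈prodA , prodA≈prodB
  where
  open CommutativeSemiring R
  open Poly R
  open Formula R q
  open BackFormula R q using (prodB≈prodTrunc)
  open SinkBoundedGF R q using (sinkBoundedGF)
  open import Relation.Binary.Reasoning.Setoid setoid
  dec = IsAreaSeq⇒SlowlyDecreasing a area
  prodTrunc≈prodA′ : prodTrunc a ≈ prodA a q
  prodTrunc≈prodA′ = prodTrunc≈prodA m a (IsAreaSeq⇒reach≤m a area)
  sinkOneGF≈prodA : sinkOneGF a q ≈ prodA a q
  sinkOneGF≈prodA = begin
    sinkOneGF a q ≈⟨ sinkOneGF≈sinkBoundedGF a ⟩
    sinkBoundedGF a 1 ≈⟨ sinkBoundedGF≈qint*prodTrunc m a dec 1 (s≤s z≤n) (s≤s z≤n) ⟩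
    (1# + 0#) * prodTrunc a ≈⟨ *-congʳ (+-identityʳ 1#) ⟩
    1# * prodTrunc a ≈⟨ *-identityˡ _ ⟩
    prodTrunc a ≈⟨ prodTrunc≈prodA′ ⟩
    prodA a q ∎
  prodA≈prodB : prodA a q ≈ prodB a q
  prodA≈prodB = trans (sym prodTrunc≈prodA′) (sym (prodB≈prodTrunc m a dec))
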